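{- In the setting described in the context, the map $\psi:\mathcal D(\pi)\to\mathcal D(\hat\pi)$ is surjective.
   Context: A planar network of order $n$ is a directed, planar, acyclic multigraph embedded in the plane with $n$ sources on the left and $n$ sinks on the right, labeled $1,\dots,n$ bottom to top; edges may carry positive integer multiplicities. For an interval $[a,b]\subseteq[n]$, the simple star network $F_{[a,b]}$ has one interior vertex $x$, edges source $i\to x\to$ sink $i$ for $i\in[a,b]$ and source $i\to$ sink $i$ otherwise. A star network $F=F_{[a_1,b_1]}\cdots F_{[a_m,b_m]}$ is built from these by any combination of concatenation (identify sink $i$ of the left piece with source $i$ of the right piece, merging edges) and condensed concatenation (additionally merge $p>1$ parallel edges between two interior vertices into one edge of multiplicity $p$); its interior vertices are $x_1,\dots,x_m$. A covering path family $\pi=(\pi_1,\dots,\pi_n)\in\Pi(F)$ consists of source-to-sink paths, $\pi_i$ from source $i$, with each edge of multiplicity $p$ on exactly $p$ paths. Components of the intersection of two paths are vertices or paths $(x_k,\dots,x_\ell)$; the paths meet at the initial vertex $x_k$ of each component, which is a crossing if they enter $x_k$ and exit $x_\ell$ in different vertical orders. A defect at $x_k$ is a triple $(\pi_i,\pi_j,k)$, $i<j$, with $\pi_i,\pi_j$ meeting at $x_k$ after having crossed an odd number of times. For paths through $x_k$: $\pi_a\prec\pi_b$ if $\pi_a$ enters $x_k$ on an edge below that of $\pi_b$; $\pi_a\sim\pi_b$ if they enter on the same edge; $\pi_a\precsim\pi_b$ if either. Setting: fix $k\in\{2,\dots,m\}$ and $\pi\in\Pi(F)$ with a defect at $x_k$.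 Let $(r,t)$ be the lexicographically least pair with $(\pi_r,\pi_t,k)$ a defect; let $s$ be the largest index with $\pi_s\sim\pi_r$ at $x_k$ and $(\pi_s,\pi_t,k)$ a defect; let $x_\ell$ be the final vertex of the rightmost crossing of $\pi_s,\pi_t$ prior to $x_k$; define $\hat\pi$ by $\hat\pi_i=\pi_i$ ($i\notin\{s,t\}$), and $\hat\pi_s$ ($\hat\pi_t$) equal to $\pi_s$ ($\pi_t$) with its $x_\ell$-to-$x_k$ subpath replaced by that of $\pi_t$ ($\pi_s$). Let $\mathcal D(\pi)$ be the set of defects $(\pi_i,\pi_j,k)$ of $\pi$ at $x_k$ with $|\{i,j\}\cap\{s,t\}|=1$, and $\mathcal D(\hat\pi)$ the analogous set for $\hat\pi$. Relations are at $x_k$. $\mathcal A=\{(\pi_i,\pi_j,k)\in\mathcal D(\pi):\pi_j\prec\pi_t\}$, $\mathcal B=\{\cdots:\pi_s\prec\pi_i\}$, $\mathcal C_1=\{\cdots:\pi_t\precsim\pi_j\prec\pi_i,\ i=s,\ j\ne t\}$, $\mathcal C_2=\{\cdots:j=t,\ \pi_t\prec\pi_i\precsim\pi_s,\ i\ne s\}$; these partition $\mathcal D(\pi)$. The map $\psi:\mathcal D(\pi)\to\mathcal D(\hat\pi)$ sends $(\pi_i,\pi_j,k)\mapsto(\hat\pi_i,\hat\pi_j,k)$ if it lies in $\mathcal A\cup\mathcal B$; $(\pi_s,\pi_j,k)\in\mathcal C_1\mapsto(\hat\pi_t,\hat\pi_j,k)$; $(\pi_i,\pi_t,k)\in\mathcal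 C_2\mapsto(\hat\pi_i,\hat\pi_s,k)$ (its image indeed lies in $\mathcal D(\hat\pi)$). -}

module Defs where

open import Data.Bool using (Bool; true; false; _∧_; _∨_; not; if_then_else_; _xor_)
open import Data.Nat using (ℕ; zero; suc; _+_; _<_; _≤_; _≤ᵇ_; _<ᵇ_; _≡ᵇ_; _⊔_; _⊓_)
open import Data.Fin using (Fin; toℕ; splitAt; _≟_)
open import Data.List using (List; []; _∷_; _++_; map; length; allFin; filterᵇ; concatMap)
open import Data.Bool.ListAction using (any; all)
open import Data.List.Membership.Propositional using (_∈_)
open import Data.Maybe using (Maybe; just; nothing)
open import Data.Product using (_×_; _,_; proj₁; proj₂; Σ; ∃)
open import Data.Sum using (_⊎_; inj₁; inj₂)
open import Data.Empty using (⊥)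
open import Data.Unit using (⊤)
open import Relation.Nullary using (¬_; yes; no)
open import Relation.Binary.PropositionalEquality using (_≡_)

-- Star networks.
-- Lines (= sources = sinks) are  Fin n, numbered 0..n-1 bottom to top
-- (paper: 1..n).  Interior vertices are  Fin m  (paper: x_1..x_m,
-- so paper's x_k is our vertex  k-1).
--
-- A star network is a binary tree of concatenations of simple stars
-- F_[a,b]; each internal node records whether that concatenation is
-- condensed.  The leaves, read left to right, are F_[a_1,b_1],...,F_[a_m,b_m].

data Star (n : ℕ) : ℕ → Set where
  leaf : (a b : Fin n) → toℕ a ≤ toℕ b → Star n 1
  cat  : (condensed : Bool) → {m₁ m₂ : ℕ} → Star n m₁ → Star n m₂ → Star n (m₁ + m₂)

-- the interval [a_k , b_k] of interior vertex k, as a Boolean test on lines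
onLineᵇ : {n m : ℕ} → Star n m → Fin m → Fin n → Bool
onLineᵇ (leaf a b _) _ i = (toℕ a ≤ᵇ toℕ i) ∧ (toℕ i ≤ᵇ toℕ b)
onLineᵇ (cat _ {m₁} L R) k i with splitAt m₁ k
... | inj₁ k' = onLineᵇ L k' i
... | inj₂ k' = onLineᵇ R k' i

-- Is the concatenation step at which interior vertices k and k' first
-- become joined (their lowest common ancestor in the tree) condensed?
lcaCond : {n m : ℕ} → Star n m → Fin m → Fin m → Bool
lcaCond (leaf _ _ _) _ _ = false
lcaCond (cat c {m₁} L R) k k' with splitAt m₁ k | splitAt m₁ k'
... | inj₁ u | inj₁ v = lcaCond L u v
... | inj₂ u | inj₂ v = lcaCond R u v
... | _      | _      = c

data Vtx (n m : ℕ) : Set where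
  src : Fin n → Vtx n m
  snk : Fin n → Vtx n m
  int : Fin m → Vtx n m

_=ᶠ_ : {k : ℕ} → Fin k → Fin k → Bool
i =ᶠ j = toℕ i ≡ᵇ toℕ j

_=ᵛ_ : {n m : ℕ} → Vtx n m → Vtx n m → Bool
src i =ᵛ src j = i =ᶠ j
snk i =ᵛ snk j = i =ᶠ j
int i =ᵛ int j = i =ᶠ j
_     =ᵛ _     = false

module _ {n m : ℕ} (F : Star n m) where

  firstOn : Fin n → List (Fin m) → Vtx n m
  firstOn i []       = snk i
  firstOn i (k ∷ ks) = if onLineᵇ F k i then int k else firstOn i ks

  next : Fin n → Vtx n m → Vtx n m
  next i (src _) = firstOn i (allFin m)
  next i (int k) = firstOn i (filterᵇ (λ k' → toℕ k <ᵇ toℕ k') (allFin m))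
  next i (snk j) = snk j

  onLineVᵇ : Fin n → Vtx n m → Bool
  onLineVᵇ i (src j) = i =ᶠ j
  onLineVᵇ i (int k) = onLineᵇ F k i
  onLineVᵇ i (snk _) = false

  -- A line-edge is the segment of line  line  starting at vertex  tail.
  -- Before condensation these are exactly the edges of the network.
  LE : Set
  LE = Vtx n m × Fin n

  tail : LE → Vtx n m
  tail = proj₁

  line : LE → Fin n
  line = proj₂

  head : LE → Vtx n m
  head e = next (line e) (tail e)

  allLE : List LE
  allLE = concatMap (λ v → map (λ i → (v , i)) (filterᵇ (λ i → onLineVᵇ i v) (allFin n)))
                    (map src (allFin n) ++ map int (allFin m))

  isSinkᵇ : Vtx n m → Bool
  isSinkᵇ (snk _) = true
  isSinkᵇ _       = false

  -- Two line-edges e, e' belong to the same edge of F: either they are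
  -- equal, or they join the same interior vertices k → k', the step joining
  -- k and k' is condensed, and every line between them also runs directly
  -- k → k' (condensation merges blocks of adjacent parallel edges).
  sameEdge : LE → LE → Bool
  sameEdge (int k , i) (int k' , i') =
    (k =ᶠ k') ∧ ((i =ᶠ i') ∨ mergedBlock)
    where
    lo = toℕ i ⊓ toℕ i'
    hi = toℕ i ⊔ toℕ i'
    tgt = next i (int k)
    mergedBlock : Bool
    mergedBlock with tgt
    ... | int k₂ = lcaCond F k k₂ ∧
                   all (λ l → not ((lo ≤ᵇ toℕ l) ∧ (toℕ l ≤ᵇ hi)) ∨
                              (onLineᵇ F k l ∧ (next l (int k) =ᵛ int k₂)))
                       (allFin n)
    ... | _      = false
  sameEdge (v , i) (v' , i') = (v =ᵛ v') ∧ (i =ᶠ i')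

  mult : LE → ℕ
  mult e = length (filterᵇ (sameEdge e) allLE)

  Path : Set
  Path = List LE

  ValidFrom : Vtx n m → Path → Set
  ValidFrom v []       = isSinkᵇ v ≡ true
  ValidFrom v (e ∷ es) = (tail e ≡ v) × (onLineVᵇ (line e) v ≡ true) × ValidFrom (head e) es

  Family : Set
  Family = Fin n → Path

  usesᵇ : Path → LE → Bool
  usesᵇ p e = any (sameEdge e) p

  Covering : Family → Set
  Covering π = ((i : Fin n) → ValidFrom (src i) (π i))
             × ((e : LE) → e ∈ allLE →
                 length (filterᵇ (λ i → usesᵇ (π i) e) (allFin n)) ≡ mult e)

  findᵉ : (LE → Bool) → Path → Maybe LE
  findᵉ f []       = nothing
  findᵉ f (e ∷ es) = if f e then just e else findᵉ f es

  inStep : Path → Vtx n m → Maybe LE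
  inStep p v = findᵉ (λ e → head e =ᵛ v) p

  outStep : Path → Vtx n m → Maybe LE
  outStep p v = findᵉ (λ e → tail e =ᵛ v) p

  -- p and q meet at interior vertex k: both pass through k, entering
  -- on different edges (k is the initial vertex of a component of p ∩ q).
  meetᵇ : Path → Path → Fin m → Bool
  meetᵇ p q k with inStep p (int k) | inStep q (int k)
  ... | just e | just e' = not (sameEdge e e')
  ... | _      | _       = false

  -- final vertex of the component of p ∩ q beginning at v
  compEndFuel : ℕ → Path → Path → Vtx n m → Vtx n m
  compEndFuel zero    p q v = v
  compEndFuel (suc f) p q v with outStep p v | outStep q v
  ... | just e | just e' = if sameEdge e e' then compEndFuel f p q (head e) else v
  ... | _      | _       = v

  compEnd : Path → Path → Vtx n m → Vtx n m
  compEnd p q v = compEndFuel (suc m) p q v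

  crossᵇ : Path → Path → Fin m → Bool
  crossᵇ p q k with meetᵇ p q k | inStep p (int k) | inStep q (int k)
                  | outStep p (compEnd p q (int k)) | outStep q (compEnd p q (int k))
  ... | true | just e | just e' | just o | just o' =
        (toℕ (line e) <ᵇ toℕ (line e')) xor (toℕ (line o) <ᵇ toℕ (line o'))
  ... | _    | _      | _       | _      | _       = false

  crossingsBefore : Path → Path → Fin m → ℕ
  crossingsBefore p q k =
    length (filterᵇ (λ j → (toℕ j <ᵇ toℕ k) ∧ crossᵇ p q j) (allFin m))

  oddᵇ : ℕ → Bool
  oddᵇ zero    = false
  oddᵇ (suc x) = not (oddᵇ x)

  Defect : Family → Fin n → Fin n → Fin m → Set
  Defect π i j k = (toℕ i < toℕ j) × (meetᵇ (π i) (π j) k ≡ true)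
                   × (oddᵇ (crossingsBefore (π i) (π j) k) ≡ true)

  PrecM : Maybe LE → Maybe LE → Set
  PrecM (just e) (just e') = (sameEdge e e' ≡ false) × (toℕ (line e) < toℕ (line e'))
  PrecM _        _         = ⊥

  SimM : Maybe LE → Maybe LE → Set
  SimM (just e) (just e') = sameEdge e e' ≡ true
  SimM _        _         = ⊥

  Prec : Path → Path → Fin m → Set
  Prec p q k = PrecM (inStep p (int k)) (inStep q (int k))

  Sim : Path → Path → Fin m → Set
  Sim p q k = SimM (inStep p (int k)) (inStep q (int k))

  PrecEq : Path → Path → Fin m → Set
  PrecEq p q k = Prec p q k ⊎ Sim p q k

  upTo : Vtx n m → Path → Path
  upTo v []       = []
  upTo v (e ∷ es) = if head e =ᵛ v then e ∷ [] else e ∷ upTo v es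

  fromV : Vtx n m → Path → Path
  fromV v []       = []
  fromV v (e ∷ es) = if tail e =ᵛ v then e ∷ es else fromV v es

  splice : Vtx n m → Vtx n m → Path → Path → Path
  splice u v p q = upTo u p ++ upTo v (fromV u q) ++ fromV v p

  swapFam : Family → Fin n → Fin n → Fin m → Fin m → Family
  swapFam π s t ℓ k i with i ≟ s | i ≟ t
  ... | yes _ | _     = splice (int ℓ) (int k) (π s) (π t)
  ... | no _  | yes _ = splice (int ℓ) (int k) (π t) (π s)
  ... | no _  | no _  = π i

  -- The sets D, A, B, C₁, C₂ (defects at x_k; pairs (i,j) stand for
  -- the triples (π_i, π_j, k))

  InST : Fin n → Fin n → Fin n → Set
  InST s t x = (x ≡ s) ⊎ (x ≡ t)

  DSet : Family → Fin n → Fin n → Fin m → Fin n → Fin n → Set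
  DSet π s t k i j = Defect π i j k ×
    ((InST s t i × ¬ InST s t j) ⊎ (¬ InST s t i × InST s t j))

  ASet BSet C₁Set C₂Set : Family → Fin n → Fin n → Fin m → Fin n → Fin n → Set
  ASet  π s t k i j = DSet π s t k i j × Prec (π j) (π t) k
  BSet  π s t k i j = DSet π s t k i j × Prec (π s) (π i) k
  C₁Set π s t k i j = DSet π s t k i j × PrecEq (π t) (π j) k × Prec (π j) (π i) k
                      × (i ≡ s) × ¬ (j ≡ t)
  C₂Set π s t k i j = DSet π s t k i j × (j ≡ t) × Prec (π t) (π i) k
                      × PrecEq (π i) (π s) k × ¬ (i ≡ s)

  PsiGraph : Family → Fin n → Fin n → Fin m → Fin n → Fin n → Fin n → Fin n → Set
  PsiGraph π s t k i j i' j' =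
      ((ASet π s t k i j ⊎ BSet π s t k i j) × (i' ≡ i) × (j' ≡ j))
    ⊎ (¬ (ASet π s t k i j ⊎ BSet π s t k i j) × C₁Set π s t k i j × (i' ≡ t) × (j' ≡ j))
    ⊎ (¬ (ASet π s t k i j ⊎ BSet π s t k i j) × ¬ C₁Set π s t k i j × C₂Set π s t k i j
        × (i' ≡ i) × (j' ≡ s))

{-# OPTIONS --safe #-}
-- Sweep two paths p from source a and q from source b, a < b, from left to right: they start in vertical
-- order and swap order exactly at their crossings.  Hence they meet at x_k after an odd number of crossings
-- iff q enters x_k on an edge below that of p, so the defects at x_k are determined by the edges on which
-- the paths enter x_k.  Swapping the x_ℓ-to-x_k subpaths of π_s and π_t yields paths again (x_ℓ precedes
-- x_k) and merely exchanges the edges on which π_s and π_t enter x_k.  A defect of π̂ involving exactly one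
-- of s, t therefore comes from a defect of π found by comparing entering edges, and that defect lies in the
-- case (A, B, C₁ or C₂) of the definition of ψ that sends it back.  The distinctness of the entering edges
-- needed along the way follows from the order of their lines, because merged parallel edges consist of
-- consecutive lines.
module Submission where

open import Defs
open import Data.Bool using (Bool; true; false; _∧_; _∨_; not; if_then_else_; _xor_; T)
open import Data.Bool.Properties using (T-≡; ¬-not)
open import Data.Empty using (⊥; ⊥-elim)
open import Data.Fin using (Fin; toℕ; splitAt; fromℕ<; _≟_) renaming (zero to fz; suc to fs; _<_ to _<ᶠ_)
open import Data.Fin.Properties using (toℕ-injective; toℕ<n; toℕ-fromℕ<)
open import Data.List using (List; []; _∷_; _++_; allFin; filterᵇ; length; map; tabulate)
open import Data.List.Membership.Propositional using (_∈_)
open import Data.List.Properties using (map-tabulate)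
open import Data.List.Membership.Propositional.Properties
  using (∈-allFin; ∈-filter⁺; ∈-filter⁻; ∈-++⁺ˡ; ∈-++⁺ʳ)
open import Data.List.Relation.Unary.All as All using (All)
open import Data.List.Relation.Unary.All.Properties using (all⁺; all⁻)
open import Data.List.Relation.Unary.AllPairs using (AllPairs; _∷_)
open import Data.List.Relation.Unary.AllPairs.Properties using (tabulate⁺-<; filter⁺)
open import Data.List.Relation.Unary.Any using (here; there)
open import Data.Maybe using (Maybe; just; nothing)
open import Data.Maybe.Properties using (just-injective)
open import Data.Nat
  using (ℕ; zero; suc; _+_; _∸_; _<_; _≤_; _≤ᵇ_; _<ᵇ_; _≡ᵇ_; _⊔_; _⊓_; z≤n; s≤s; z<s)
open import Data.Nat.Properties hiding (_≟_)
open import Data.Product using (_×_; _,_; proj₁; proj₂; Σ; ∃₂; map₁; map₂)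
open import Data.Sum using (_⊎_; inj₁; inj₂; [_,_])
open import Function using (_∘_; id; Equivalence)
open import Relation.Binary.Definitions using (tri<; tri≈; tri>)
open import Relation.Binary.PropositionalEquality using (_≡_; _≢_; refl; sym; trans; cong; cong₂; subst; ≢-sym)
open import Relation.Nullary using (¬_; Dec; yes; no)
open import Relation.Nullary.Decidable using (T?)

true≢false : true ≢ false
true≢false ()

nothing≢just : ∀ {A : Set} {x : A} → nothing ≢ just x
nothing≢just ()

≡true⇒T : ∀ {b} → b ≡ true → T b
≡true⇒T = Equivalence.from T-≡

T⇒≡true : ∀ {b} → T b → b ≡ true
T⇒≡true = Equivalence.to T-≡

∧≡true⇒ˡ : ∀ {a b} → (a ∧ b) ≡ true → a ≡ true
∧≡true⇒ˡ {true} _ = refl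

∧≡true⇒ʳ : ∀ {a b} → (a ∧ b) ≡ true → b ≡ true
∧≡true⇒ʳ {true} p = p

≡ᵇ≡true⇒≡ : ∀ {x y} → (x ≡ᵇ y) ≡ true → x ≡ y
≡ᵇ≡true⇒≡ {x} {y} p = ≡ᵇ⇒≡ x y (≡true⇒T p)

≡ᵇ-refl : ∀ x → (x ≡ᵇ x) ≡ true
≡ᵇ-refl x = T⇒≡true (≡⇒≡ᵇ x x refl)

≡ᵇ-false : ∀ {x y} → x ≢ y → (x ≡ᵇ y) ≡ false
≡ᵇ-false {x} {y} x≢y with x ≡ᵇ y in eq
... | true  = ⊥-elim (x≢y (≡ᵇ≡true⇒≡ eq))
... | false = refl

<ᵇ≡true⇒< : ∀ {x y} → (x <ᵇ y) ≡ true → x < y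
<ᵇ≡true⇒< {x} {y} p = <ᵇ⇒< x y (≡true⇒T p)

<⇒<ᵇ≡true : ∀ {x y} → x < y → (x <ᵇ y) ≡ true
<⇒<ᵇ≡true p = T⇒≡true (<⇒<ᵇ p)

≤ᵇ≡true⇒≤ : ∀ {x y} → (x ≤ᵇ y) ≡ true → x ≤ y
≤ᵇ≡true⇒≤ {x} {y} p = ≤ᵇ⇒≤ x y (≡true⇒T p)

≤⇒≤ᵇ≡true : ∀ {x y} → x ≤ y → (x ≤ᵇ y) ≡ true
≤⇒≤ᵇ≡true p = T⇒≡true (≤⇒≤ᵇ p)

≮⇒<ᵇ≡false : ∀ {x y} → ¬ (x < y) → (x <ᵇ y) ≡ false
≮⇒<ᵇ≡false {x} {y} x≮y with x <ᵇ y in eq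
... | true  = ⊥-elim (x≮y (<ᵇ≡true⇒< eq))
... | false = refl

<ᵇ≡false⇒≮ : ∀ {x y} → (x <ᵇ y) ≡ false → ¬ (x < y)
<ᵇ≡false⇒≮ eq x<y = true≢false (trans (sym (<⇒<ᵇ≡true x<y)) eq)

<ᵇ-flip : ∀ {x y} → x ≢ y → (x <ᵇ y) ≡ not (y <ᵇ x)
<ᵇ-flip {x} {y} x≢y with <-cmp x y
... | tri< x<y _ _ rewrite <⇒<ᵇ≡true x<y | ≮⇒<ᵇ≡false (<⇒≯ x<y) = refl
... | tri≈ _ x≡y _ = ⊥-elim (x≢y x≡y)
... | tri> _ _ y<x rewrite <⇒<ᵇ≡true y<x | ≮⇒<ᵇ≡false (<⇒≯ y<x) = refl

xor-order : ∀ entry exit c crossed → entry ≡ c → crossed ≡ (not entry xor not exit) →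
            exit ≡ (c xor crossed)
xor-order true  true  .true  _ refl refl = refl
xor-order true  false .true  _ refl refl = refl
xor-order false true  .false _ refl refl = refl
xor-order false false .false _ refl refl = refl

=ᶠ⇒≡ : ∀ {k} {i j : Fin k} → (i =ᶠ j) ≡ true → i ≡ j
=ᶠ⇒≡ p = toℕ-injective (≡ᵇ≡true⇒≡ p)

=ᶠ-refl : ∀ {k} (i : Fin k) → (i =ᶠ i) ≡ true
=ᶠ-refl i = ≡ᵇ-refl (toℕ i)

=ᵛ⇒≡ : ∀ {n m} {v w : Vtx n m} → (v =ᵛ w) ≡ true → v ≡ w
=ᵛ⇒≡ {v = src i} {src j} p = cong src (=ᶠ⇒≡ p)
=ᵛ⇒≡ {v = snk i} {snk j} p = cong snk (=ᶠ⇒≡ p)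
=ᵛ⇒≡ {v = int i} {int j} p = cong int (=ᶠ⇒≡ p)
=ᵛ⇒≡ {v = src _} {snk _} ()
=ᵛ⇒≡ {v = src _} {int _} ()
=ᵛ⇒≡ {v = snk _} {src _} ()
=ᵛ⇒≡ {v = snk _} {int _} ()
=ᵛ⇒≡ {v = int _} {src _} ()
=ᵛ⇒≡ {v = int _} {snk _} ()

=ᵛ-refl : ∀ {n m} (v : Vtx n m) → (v =ᵛ v) ≡ true
=ᵛ-refl (src i) = =ᶠ-refl i
=ᵛ-refl (snk i) = =ᶠ-refl i
=ᵛ-refl (int i) = =ᶠ-refl i

=ᵛ-≢ : ∀ {n m} {v w : Vtx n m} → v ≢ w → (v =ᵛ w) ≡ false
=ᵛ-≢ {v = v} {w} v≢w with v =ᵛ w in eq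
... | true  = ⊥-elim (v≢w (=ᵛ⇒≡ eq))
... | false = refl

length-filterᵇ-map : ∀ {A B : Set} (P : B → Bool) (f : A → B) (xs : List A) →
  length (filterᵇ P (map f xs)) ≡ length (filterᵇ (P ∘ f) xs)
length-filterᵇ-map P f []       = refl
length-filterᵇ-map P f (x ∷ xs) with P (f x)
... | true  = cong suc (length-filterᵇ-map P f xs)
... | false = length-filterᵇ-map P f xs

length-filterᵇ-false : ∀ {A : Set} (xs : List A) → length (filterᵇ (λ _ → false) xs) ≡ 0
length-filterᵇ-false []       = refl
length-filterᵇ-false (_ ∷ xs) = length-filterᵇ-false xs

length-filterᵇ-tabulate-suc : ∀ {m} (P : Fin (suc m) → Bool) →
  length (filterᵇ P (tabulate fs)) ≡ length (filterᵇ (P ∘ fs) (allFin m))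
length-filterᵇ-tabulate-suc {m} P =
  trans (cong (length ∘ filterᵇ P) (sym (map-tabulate id fs))) (length-filterᵇ-map P fs (allFin m))

count-at : ∀ {m} (g : Fin m → Bool) (w : Fin m) →
  length (filterᵇ (λ j → (toℕ j ≡ᵇ toℕ w) ∧ g j) (allFin m)) ≡ (if g w then 1 else 0)
count-at {suc m} g fz with g fz
... | true  = cong suc (trans (length-filterᵇ-tabulate-suc {m} _) (length-filterᵇ-false (allFin m)))
... | false = trans (length-filterᵇ-tabulate-suc {m} _) (length-filterᵇ-false (allFin m))
count-at {suc m} g (fs w) = trans (length-filterᵇ-tabulate-suc {m} _) (count-at (g ∘ fs) w)

count-below-suc : ∀ {m} (g : Fin m → Bool) y (js : List (Fin m)) →
  length (filterᵇ (λ j → (toℕ j <ᵇ suc y) ∧ g j) js) ≡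
  length (filterᵇ (λ j → (toℕ j <ᵇ y) ∧ g j) js) + length (filterᵇ (λ j → (toℕ j ≡ᵇ y) ∧ g j) js)
count-below-suc g y [] = refl
count-below-suc g y (j ∷ js) with <-cmp (toℕ j) y
... | tri< j<y _ _
  rewrite <⇒<ᵇ≡true j<y | <⇒<ᵇ≡true (m<n⇒m<1+n j<y) | ≡ᵇ-false (<⇒≢ j<y) with g j
...   | true  = cong suc (count-below-suc g y js)
...   | false = count-below-suc g y js
count-below-suc g y (j ∷ js) | tri≈ _ refl _
  rewrite <⇒<ᵇ≡true (n<1+n (toℕ j)) | ≮⇒<ᵇ≡false (<-irrefl {toℕ j} refl) | ≡ᵇ-refl (toℕ j) with g j
...   | true  = trans (cong suc (count-below-suc g (toℕ j) js)) (sym (+-suc _ _))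
...   | false = count-below-suc g (toℕ j) js
count-below-suc g y (j ∷ js) | tri> _ _ y<j
  rewrite ≮⇒<ᵇ≡false {toℕ j} {suc y} (≤⇒≯ y<j) | ≮⇒<ᵇ≡false (<⇒≯ y<j)
        | ≡ᵇ-false (≢-sym (<⇒≢ y<j)) =
  count-below-suc g y js

-- Geometry of a star network

-- Vertices in their left-to-right order: sources, x₁, …, x_m, sinks.
rank : ∀ {n m} → Vtx n m → ℕ
rank (src _)         = 0
rank (int k)         = suc (toℕ k)
rank {m = m} (snk _) = suc m

rank≤1+m : ∀ {n m} (v : Vtx n m) → rank v ≤ suc m
rank≤1+m (src _) = z≤n
rank≤1+m (int k) = m≤n⇒m≤1+n (toℕ<n k)
rank≤1+m (snk _) = ≤-refl

rank≡⇒int : ∀ {n m} (v : Vtx n m) (k : Fin m) → rank v ≡ suc (toℕ k) → v ≡ int k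
rank≡⇒int (src _)  k ()
rank≡⇒int (int k′) k eq = cong int (toℕ-injective (suc-injective eq))
rank≡⇒int (snk _)  k eq = ⊥-elim (<-irrefl (sym (suc-injective eq)) (toℕ<n k))

rank<⇒≢ : ∀ {n m} {v w : Vtx n m} → rank v < rank w → v ≢ w
rank<⇒≢ lt refl = <-irrefl refl lt

onLine-convex : ∀ {n m} (F : Star n m) (k : Fin m) {i x l : Fin n} →
  onLineᵇ F k i ≡ true → onLineᵇ F k l ≡ true → toℕ i ≤ toℕ x → toℕ x ≤ toℕ l →
  onLineᵇ F k x ≡ true
onLine-convex (leaf a b _) _ {i} {x} {l} oi ol i≤x x≤l =
  cong₂ _∧_ (≤⇒≤ᵇ≡true (≤-trans a≤i i≤x)) (≤⇒≤ᵇ≡true (≤-trans x≤l l≤b))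
  where
  a≤i = ≤ᵇ≡true⇒≤ {toℕ a} (∧≡true⇒ˡ {toℕ a ≤ᵇ toℕ i} oi)
  l≤b = ≤ᵇ≡true⇒≤ {toℕ l} (∧≡true⇒ʳ {toℕ a ≤ᵇ toℕ l} ol)
onLine-convex (cat _ {m₁} L R) k oi ol i≤x x≤l with splitAt m₁ k
... | inj₁ k′ = onLine-convex L k′ oi ol i≤x x≤l
... | inj₂ k′ = onLine-convex R k′ oi ol i≤x x≤l

module _ {n m : ℕ} (F : Star n m) where

  onLine-offLine-≢ : ∀ k {z x : Fin n} → onLineᵇ F k z ≡ true → onLineᵇ F k x ≡ false →
                     toℕ z ≢ toℕ x
  onLine-offLine-≢ k oz ox z≡x with toℕ-injective z≡x
  ... | refl = true≢false (trans (sym oz) ox)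

  offLine-side : ∀ (k : Fin m) {i x l : Fin n} →
    onLineᵇ F k i ≡ true → onLineᵇ F k l ≡ true → onLineᵇ F k x ≡ false →
    (toℕ x <ᵇ toℕ i) ≡ (toℕ x <ᵇ toℕ l)
  offLine-side k {i} {x} {l} oi ol ox with <-cmp (toℕ x) (toℕ i) | <-cmp (toℕ x) (toℕ l)
  ... | tri< x<i _ _ | tri< x<l _ _ = trans (<⇒<ᵇ≡true x<i) (sym (<⇒<ᵇ≡true x<l))
  ... | tri> _ _ i<x | tri> _ _ l<x = trans (≮⇒<ᵇ≡false (<⇒≯ i<x)) (sym (≮⇒<ᵇ≡false (<⇒≯ l<x)))
  ... | tri≈ _ x≡i _ | _ = ⊥-elim (onLine-offLine-≢ k oi ox (sym x≡i))
  ... | _ | tri≈ _ x≡l _ = ⊥-elim (onLine-offLine-≢ k ol ox (sym x≡l))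
  ... | tri< x<i _ _ | tri> _ _ l<x =
    ⊥-elim (true≢false (trans (sym (onLine-convex F k ol oi (<⇒≤ l<x) (<⇒≤ x<i))) ox))
  ... | tri> _ _ i<x | tri< x<l _ _ =
    ⊥-elim (true≢false (trans (sym (onLine-convex F k oi ol (<⇒≤ i<x) (<⇒≤ x<l))) ox))

  offLine-side′ : ∀ (k : Fin m) {i x l : Fin n} →
    onLineᵇ F k i ≡ true → onLineᵇ F k l ≡ true → onLineᵇ F k x ≡ false →
    (toℕ i <ᵇ toℕ x) ≡ (toℕ l <ᵇ toℕ x)
  offLine-side′ k oi ol ox =
    trans (<ᵇ-flip (onLine-offLine-≢ k oi ox))
          (trans (cong not (offLine-side k oi ol ox)) (sym (<ᵇ-flip (onLine-offLine-≢ k ol ox))))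

  later : Fin m → Fin m → Bool
  later k k′ = toℕ k <ᵇ toℕ k′

  firstOn-int : ∀ i (L : List (Fin m)) {k} → firstOn F i L ≡ int k → k ∈ L × onLineᵇ F k i ≡ true
  firstOn-int i (k′ ∷ L) eq with onLineᵇ F k′ i in on
  firstOn-int i (k′ ∷ L) refl | true = here refl , on
  ... | false = map₁ there (firstOn-int i L eq)

  firstOn-rank-lower : ∀ i (L : List (Fin m)) b → b < suc m → (∀ k → k ∈ L → b < suc (toℕ k)) →
                       b < rank (firstOn F i L)
  firstOn-rank-lower i []       b b<1+m _ = b<1+m
  firstOn-rank-lower i (k′ ∷ L) b b<1+m h with onLineᵇ F k′ i
  ... | true  = h k′ (here refl)
  ... | false = firstOn-rank-lower i L b b<1+m (λ k k∈L → h k (there k∈L))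

  firstOn-minimal : ∀ i {L : List (Fin m)} → AllPairs _<ᶠ_ L → ∀ {k} → k ∈ L →
                    onLineᵇ F k i ≡ true → rank (firstOn F i L) ≤ suc (toℕ k)
  firstOn-minimal i {k′ ∷ L} (k′<L ∷ sorted) k∈ on with onLineᵇ F k′ i in on′
  firstOn-minimal i {k′ ∷ L} (k′<L ∷ sorted) (here refl) on | true  = ≤-refl
  firstOn-minimal i {k′ ∷ L} (k′<L ∷ sorted) (there k∈) on | true  = s≤s (<⇒≤ (All.lookup k′<L k∈))
  firstOn-minimal i {k′ ∷ L} (k′<L ∷ sorted) (here refl) on | false =
    ⊥-elim (true≢false (trans (sym on) on′))
  firstOn-minimal i {k′ ∷ L} (k′<L ∷ sorted) (there k∈) on | false = firstOn-minimal i sorted k∈ on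

  allFin-sorted : AllPairs _<ᶠ_ (allFin m)
  allFin-sorted = tabulate⁺-< (λ i<j → i<j)

  rank-next : ∀ i (v : Vtx n m) → onLineVᵇ F i v ≡ true → rank v < rank (next F i v)
  rank-next i (src _) _ = firstOn-rank-lower i (allFin m) 0 z<s (λ _ _ → z<s)
  rank-next i (int k) _ = firstOn-rank-lower i (filterᵇ (later k) (allFin m)) (suc (toℕ k)) (s≤s (toℕ<n k))
    (λ k′ k′∈ → s≤s (<ᵇ⇒< (toℕ k) (toℕ k′)
                            (proj₂ (∈-filter⁻ (T? ∘ later k) {xs = allFin m} k′∈))))

  next-onLine : ∀ i (v : Vtx n m) {k} → next F i v ≡ int k → onLineᵇ F k i ≡ true
  next-onLine i (src _) eq = proj₂ (firstOn-int i (allFin m) eq)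
  next-onLine i (int k) eq = proj₂ (firstOn-int i (filterᵇ (later k) (allFin m)) eq)

  next-minimal : ∀ i (v : Vtx n m) k → onLineᵇ F k i ≡ true → rank v < suc (toℕ k) →
                 rank (next F i v) ≤ suc (toℕ k)
  next-minimal i (src _) k on _ = firstOn-minimal i allFin-sorted (∈-allFin k) on
  next-minimal i (int k′) k on k′<k =
    firstOn-minimal i (filter⁺ (T? ∘ later k′) allFin-sorted)
      (∈-filter⁺ (T? ∘ later k′) (∈-allFin k) (<⇒<ᵇ (≤-pred k′<k))) on
  next-minimal i (snk _) k on m<k = ⊥-elim (<-irrefl refl (<-trans (≤-pred m<k) (toℕ<n k)))

  record Merged (k : Fin m) (i i′ : Fin n) : Set where
    field
      target    : Fin m
      next≡     : next F i (int k) ≡ int target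
      condensed : lcaCond F k target ≡ true
      block     : ∀ l → toℕ i ⊓ toℕ i′ ≤ toℕ l → toℕ l ≤ toℕ i ⊔ toℕ i′ →
                  onLineᵇ F k l ≡ true × next F l (int k) ≡ int target

  data SameEdge : LE F → LE F → Set where
    same   : ∀ {e} → SameEdge e e
    merged : ∀ {k i i′} → Merged k i i′ → SameEdge (int k , i) (int k , i′)

  sameEdge⇒SameEdge : ∀ e f → sameEdge F e f ≡ true → SameEdge e f
  sameEdge⇒SameEdge (int k , i) (int k′ , i′) eq
    with k =ᶠ k′ in k≡ | i =ᶠ i′ in i≡
  ... | true | true with =ᶠ⇒≡ {i = k} {k′} k≡ | =ᶠ⇒≡ {i = i} {i′} i≡
  ...   | refl | refl = same
  sameEdge⇒SameEdge (int k , i) (int k′ , i′) eq | true | false with next F i (int k) in nx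
  ... | int k₂ with =ᶠ⇒≡ {i = k} {k′} k≡
  ...   | refl = merged record { target = k₂ ; next≡ = nx ; condensed = ∧≡true⇒ˡ eq ; block = block }
    where
    block : ∀ l → toℕ i ⊓ toℕ i′ ≤ toℕ l → toℕ l ≤ toℕ i ⊔ toℕ i′ →
            onLineᵇ F k l ≡ true × next F l (int k) ≡ int k₂
    block l lo hi
      with T⇒≡true (All.lookup (all⁺ _ (allFin n) (≡true⇒T (∧≡true⇒ʳ {lcaCond F k k₂} eq)))
                                (∈-allFin l))
    ... | at-l rewrite ≤⇒≤ᵇ≡true lo | ≤⇒≤ᵇ≡true hi =
      ∧≡true⇒ˡ at-l , =ᵛ⇒≡ (∧≡true⇒ʳ {onLineᵇ F k l} at-l)
  sameEdge⇒SameEdge (int k , i) (int k′ , i′) () | true | false | src _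
  sameEdge⇒SameEdge (int k , i) (int k′ , i′) () | true | false | snk _
  sameEdge⇒SameEdge (src a , i) (src b , i′) eq
    with =ᶠ⇒≡ {i = a} {b} (∧≡true⇒ˡ eq) | =ᶠ⇒≡ {i = i} {i′} (∧≡true⇒ʳ {a =ᶠ b} eq)
  ... | refl | refl = same
  sameEdge⇒SameEdge (snk a , i) (snk b , i′) eq
    with =ᶠ⇒≡ {i = a} {b} (∧≡true⇒ˡ eq) | =ᶠ⇒≡ {i = i} {i′} (∧≡true⇒ʳ {a =ᶠ b} eq)
  ... | refl | refl = same

  Merged⇒sameEdge : ∀ {k i i′} → Merged k i i′ → sameEdge F (int k , i) (int k , i′) ≡ true
  Merged⇒sameEdge {k} {i} {i′} mb rewrite =ᶠ-refl k with toℕ i ≡ᵇ toℕ i′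
  ... | true  = refl
  ... | false rewrite Merged.next≡ mb | Merged.condensed mb =
    T⇒≡true (all⁻ _ {xs = allFin n} (All.tabulate (λ {l} _ → ≡true⇒T (between l))))
    where
    between : ∀ l → (not ((toℕ i ⊓ toℕ i′ ≤ᵇ toℕ l) ∧ (toℕ l ≤ᵇ toℕ i ⊔ toℕ i′)) ∨
                     (onLineᵇ F k l ∧ (next F l (int k) =ᵛ int (Merged.target mb)))) ≡ true
    between l with toℕ i ⊓ toℕ i′ ≤ᵇ toℕ l in lo | toℕ l ≤ᵇ toℕ i ⊔ toℕ i′ in hi
    ... | false | _     = refl
    ... | true  | false = refl
    ... | true  | true
      with Merged.block mb l (≤ᵇ≡true⇒≤ {toℕ i ⊓ toℕ i′} lo) (≤ᵇ≡true⇒≤ {toℕ l} hi)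
    ...   | on , nx rewrite on | nx = =ᵛ-refl {n} (int (Merged.target mb))

  Merged-next : ∀ {k i i′} (mb : Merged k i i′) → next F i′ (int k) ≡ int (Merged.target mb)
  Merged-next {i = i} {i′} mb =
    proj₂ (Merged.block mb i′ (m⊓n≤n (toℕ i) (toℕ i′)) (m≤n⊔m (toℕ i) (toℕ i′)))

  Merged-sym : ∀ {k i i′} → Merged k i i′ → Merged k i′ i
  Merged-sym {i = i} {i′} mb = record
    { target    = Merged.target mb
    ; next≡     = Merged-next mb
    ; condensed = Merged.condensed mb
    ; block     = λ l lo hi → Merged.block mb l (subst (_≤ toℕ l) (⊓-comm (toℕ i′) (toℕ i)) lo)
                                                (subst (toℕ l ≤_) (⊔-comm (toℕ i′) (toℕ i)) hi)
    }

  sameEdge-refl : ∀ e → sameEdge F e e ≡ true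
  sameEdge-refl (int k , i) rewrite =ᶠ-refl k | =ᶠ-refl i = refl
  sameEdge-refl (src a , i) rewrite =ᶠ-refl a | =ᶠ-refl i = refl
  sameEdge-refl (snk a , i) rewrite =ᶠ-refl a | =ᶠ-refl i = refl

  sameEdge-sym : ∀ e f → sameEdge F e f ≡ true → sameEdge F f e ≡ true
  sameEdge-sym e f eq with sameEdge⇒SameEdge e f eq
  ... | same      = eq
  ... | merged mb = Merged⇒sameEdge (Merged-sym mb)

  sameEdge-sym-false : ∀ e f → sameEdge F e f ≡ false → sameEdge F f e ≡ false
  sameEdge-sym-false e f eq with sameEdge F f e in eq′
  ... | true  = ⊥-elim (true≢false (trans (sym (sameEdge-sym f e eq′)) eq))
  ... | false = refl

  sameEdge-tail : ∀ e f → sameEdge F e f ≡ true → tail F e ≡ tail F f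
  sameEdge-tail e f eq with sameEdge⇒SameEdge e f eq
  ... | same     = refl
  ... | merged _ = refl

  sameEdge-head : ∀ e f → sameEdge F e f ≡ true → head F e ≡ head F f
  sameEdge-head e f eq with sameEdge⇒SameEdge e f eq
  ... | same      = refl
  ... | merged mb = trans (Merged.next≡ mb) (sym (Merged-next mb))

  Proper : LE F → Set
  Proper e = onLineVᵇ F (line F e) (tail F e) ≡ true

  -- Position y is the strip between the vertices of rank y and y + 1.
  Covers : LE F → ℕ → Set
  Covers e y = rank (tail F e) ≤ y × y < rank (head F e)

  rank-tail<head : ∀ e → Proper e → rank (tail F e) < rank (head F e)
  rank-tail<head (v , i) = rank-next i v

  covers-before-head : ∀ e {k} → Proper e → head F e ≡ int k → Covers e (toℕ k)
  covers-before-head e {k} pe he =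
    ≤-pred (subst (λ h → rank (tail F e) < rank h) he (rank-tail<head e pe)) ,
    subst (λ h → toℕ k < rank h) (sym he) ≤-refl

  covers-at-tail : ∀ e → Proper e → Covers e (rank (tail F e))
  covers-at-tail e pe = ≤-refl , rank-tail<head e pe

  next-not-past : ∀ {i} v w {y} → rank v < rank w → onLineVᵇ F i w ≡ true → rank w ≤ y →
                  ¬ (y < rank (next F i v))
  next-not-past {i} v (int k) v<w on w≤y y<v⁺ =
    <-irrefl refl (≤-trans y<v⁺ (≤-trans (next-minimal i v k on v<w) w≤y))

  covers-unique : ∀ v w {i y} → Proper (v , i) → Proper (w , i) → Covers (v , i) y → Covers (w , i) y →
                  v ≡ w
  covers-unique v w {i} pv pw (v≤y , y<v⁺) (w≤y , y<w⁺) with <-cmp (rank v) (rank w)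
  ... | tri< v<w _ _ = ⊥-elim (next-not-past v w v<w pw w≤y y<v⁺)
  ... | tri> _ _ w<v = ⊥-elim (next-not-past w v w<v pv v≤y y<w⁺)
  ... | tri≈ _ v≈w _ = same-rank v w v≈w pv pw
    where
    same-rank : ∀ v w → rank v ≡ rank w → onLineVᵇ F i v ≡ true → onLineVᵇ F i w ≡ true → v ≡ w
    same-rank (src a) (src b) _  pv pw = cong src (trans (sym (=ᶠ⇒≡ {i = i} {a} pv)) (=ᶠ⇒≡ {i = i} {b} pw))
    same-rank (int a) (int b) eq _  _  = cong int (toℕ-injective (suc-injective eq))

  next-injective : ∀ v w {i k} → Proper (v , i) → Proper (w , i) → next F i v ≡ int k → next F i w ≡ int k →
                   v ≡ w
  next-injective v w {i} pv pw nv nw =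
    covers-unique v w pv pw (covers-before-head (v , i) pv nv) (covers-before-head (w , i) pw nw)

  sameEdge-between : ∀ k (e₁ e₂ e₃ : LE F) → Proper e₂ → head F e₁ ≡ int k → head F e₂ ≡ int k →
    toℕ (line F e₁) < toℕ (line F e₂) → toℕ (line F e₂) < toℕ (line F e₃) →
    sameEdge F e₁ e₃ ≡ true → sameEdge F e₂ e₃ ≡ true
  sameEdge-between k e₁ e₂ e₃ p₂ h₁ h₂ l₁<l₂ l₂<l₃ s₁₃ with sameEdge⇒SameEdge e₁ e₃ s₁₃
  ... | same = ⊥-elim (<-asym l₁<l₂ l₂<l₃)
  sameEdge-between k (int k₀ , l₁) (w , l₂) (int k₀ , l₃) p₂ h₁ h₂ l₁<l₂ l₂<l₃ s₁₃ | merged mb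
    with trans (sym (Merged.next≡ mb)) h₁
  ... | refl with Merged.block mb l₂ (≤-trans (m⊓n≤m (toℕ l₁) (toℕ l₃)) (<⇒≤ l₁<l₂))
                                    (≤-trans (<⇒≤ l₂<l₃) (m≤n⊔m (toℕ l₁) (toℕ l₃)))
  ...   | on₂ , nx₂ with next-injective w (int k₀) p₂ on₂ h₂ nx₂
  ...     | refl = Merged⇒sameEdge record
    { target    = k
    ; next≡     = nx₂
    ; condensed = Merged.condensed mb
    ; block     = λ l lo hi → Merged.block mb l (≤-trans (⊓-monoˡ-≤ (toℕ l₃) (<⇒≤ l₁<l₂)) lo)
                    (≤-trans hi (≤-trans (≤-reflexive (m≤n⇒m⊔n≡n (<⇒≤ l₂<l₃)))
                                         (m≤n⊔m (toℕ l₁) (toℕ l₃))))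
    }

  -- Paths

  edgeAt : Path F → ℕ → Maybe (LE F)
  edgeAt []       y = nothing
  edgeAt (e ∷ es) y = if y <ᵇ rank (head F e) then just e else edgeAt es y

  valid-∈ : ∀ {v p e} → ValidFrom F v p → e ∈ p → Proper e × rank v ≤ rank (tail F e)
  valid-∈ (refl , pe , _) (here refl) = pe , ≤-refl
  valid-∈ {v} {e₀ ∷ _} (refl , pe₀ , vp) (there e∈) =
    proj₁ (valid-∈ vp e∈) , <⇒≤ (<-≤-trans (rank-next (line F e₀) v pe₀) (proj₂ (valid-∈ vp e∈)))

  valid-proper : ∀ {v p e} → ValidFrom F v p → e ∈ p → Proper e
  valid-proper vp e∈ = proj₁ (valid-∈ vp e∈)

  valid-head : ∀ {v p e} → ValidFrom F v p → e ∈ p → rank v < rank (head F e)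
  valid-head {e = e} vp e∈ = ≤-<-trans (proj₂ (valid-∈ vp e∈)) (rank-tail<head e (valid-proper vp e∈))

  edgeAt-covers : ∀ {v p e y} → ValidFrom F v p → e ∈ p → Covers e y → edgeAt p y ≡ just e
  edgeAt-covers (refl , _ , _) (here refl) (_ , y<h) rewrite <⇒<ᵇ≡true y<h = refl
  edgeAt-covers {p = e₀ ∷ _} {y = y} (refl , _ , vp) (there e∈) (t≤y , y<h)
    rewrite ≮⇒<ᵇ≡false {y} {rank (head F e₀)} (≤⇒≯ (≤-trans (proj₂ (valid-∈ vp e∈)) t≤y)) =
    edgeAt-covers vp e∈ (t≤y , y<h)

  path-covers-unique : ∀ {v p e e′ y} → ValidFrom F v p → e ∈ p → e′ ∈ p → Covers e y → Covers e′ y →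
                       e ≡ e′
  path-covers-unique vp e∈ e′∈ c c′ =
    just-injective (trans (sym (edgeAt-covers vp e∈ c)) (edgeAt-covers vp e′∈ c′))

  path-covers : ∀ {v p y} → ValidFrom F v p → rank v ≤ y → y < suc m →
                Σ (LE F) λ e → e ∈ p × Covers e y
  path-covers {snk _} {[]}     _ v≤y y<1+m = ⊥-elim (<-irrefl refl (<-≤-trans y<1+m v≤y))
  path-covers {src _} {[]}     () _ _
  path-covers {int _} {[]}     () _ _
  path-covers {v} {e₀ ∷ _} {y} (refl , _ , vp) v≤y y<1+m with y <ᵇ rank (head F e₀) in y<h
  ... | true  = e₀ , here refl , v≤y , <ᵇ≡true⇒< y<h
  ... | false with path-covers vp (≮⇒≥ (<ᵇ≡false⇒≮ y<h)) y<1+m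
  ...   | e , e∈ , c = e , there e∈ , c

  edgeAt-zero : ∀ {a p} → ValidFrom F (src a) p → edgeAt p 0 ≡ just (src a , a)
  edgeAt-zero {a} {(_ , i) ∷ _} (refl , on , _) rewrite <⇒<ᵇ≡true (rank-next i (src a) on) =
    cong (λ j → just (src a , j)) (=ᶠ⇒≡ on)

  entering-covers : ∀ {v p e k} → ValidFrom F v p → e ∈ p → head F e ≡ int k → Covers e (toℕ k)
  entering-covers vp e∈ he = covers-before-head _ (valid-proper vp e∈) he

  covers-step : ∀ e (w : Fin m) → Covers e (toℕ w) → head F e ≡ int w ⊎ Covers e (suc (toℕ w))
  covers-step e w (t≤w , w<h) with m≤n⇒m<n∨m≡n w<h
  ... | inj₁ w+1<h = inj₂ (m≤n⇒m≤1+n t≤w , w+1<h)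
  ... | inj₂ w+1≡h = inj₁ (rank≡⇒int (head F e) w (sym w+1≡h))

  distinct-edges-distinct-lines : ∀ {e f y} → Proper e → Proper f → Covers e y → Covers f y →
    sameEdge F e f ≡ false → toℕ (line F e) ≢ toℕ (line F f)
  distinct-edges-distinct-lines {v , i} {w , i′} pe pf ce cf ¬same i≡i′ with toℕ-injective i≡i′
  ... | refl with covers-unique v w pe pf ce cf
  ...   | refl = true≢false (trans (sym (sameEdge-refl (v , i))) ¬same)

  findᵉ-just : ∀ (f : LE F → Bool) p {e} → findᵉ F f p ≡ just e → e ∈ p × f e ≡ true
  findᵉ-just f (e₀ ∷ es) eq with f e₀ in fe₀
  findᵉ-just f (e₀ ∷ es) refl | true  = here refl , fe₀
  ... | false = map₁ there (findᵉ-just f es eq)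

  findᵉ-unique : ∀ (f : LE F → Bool) p e → e ∈ p → f e ≡ true →
                 (∀ e′ → e′ ∈ p → f e′ ≡ true → e′ ≡ e) → findᵉ F f p ≡ just e
  findᵉ-unique f (e₀ ∷ es) e e∈ fe uniq with f e₀ in fe₀
  ... | true = cong just (uniq e₀ (here refl) fe₀)
  findᵉ-unique f (e₀ ∷ es) e (here refl) fe uniq | false = ⊥-elim (true≢false (trans (sym fe) fe₀))
  findᵉ-unique f (e₀ ∷ es) e (there e∈) fe uniq | false =
    findᵉ-unique f es e e∈ fe (λ e′ → uniq e′ ∘ there)

  findᵉ-none : ∀ (f : LE F → Bool) p → (∀ e → e ∈ p → f e ≡ false) → findᵉ F f p ≡ nothing
  findᵉ-none f []        _    = refl
  findᵉ-none f (e₀ ∷ es) none rewrite none e₀ (here refl) = findᵉ-none f es (λ e → none e ∘ there)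

  inStep-just : ∀ p w {e} → inStep F p w ≡ just e → e ∈ p × head F e ≡ w
  inStep-just p w eq = map₂ =ᵛ⇒≡ (findᵉ-just _ p eq)

  outStep-just : ∀ p w {e} → outStep F p w ≡ just e → e ∈ p × tail F e ≡ w
  outStep-just p w eq = map₂ =ᵛ⇒≡ (findᵉ-just _ p eq)

  outStep-advances : ∀ {u p v o} → ValidFrom F u p → outStep F p v ≡ just o → rank v < rank (head F o)
  outStep-advances {p = p} {v} {o} vp op with outStep-just p v op
  ... | o∈ , refl = rank-tail<head o (valid-proper vp o∈)

  inStep-entering : ∀ {v p e k} → ValidFrom F v p → e ∈ p → head F e ≡ int k →
                    inStep F p (int k) ≡ just e
  inStep-entering {p = p} {e} {k} vp e∈ he =
    findᵉ-unique _ p e e∈ (trans (cong (_=ᵛ int k) he) (=ᵛ-refl {n} (int k)))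
      (λ e′ e′∈ he′ → path-covers-unique vp e′∈ e∈ (entering-covers vp e′∈ (=ᵛ⇒≡ he′))
                                                  (entering-covers vp e∈ he))

  outStep-leaving : ∀ {v p e w} → ValidFrom F v p → e ∈ p → tail F e ≡ w → outStep F p w ≡ just e
  outStep-leaving {p = p} {e} vp e∈ refl =
    findᵉ-unique _ p e e∈ (=ᵛ-refl (tail F e))
      (λ e′ e′∈ te′ → path-covers-unique vp e′∈ e∈
        (subst (λ t → Covers e′ (rank t)) (=ᵛ⇒≡ te′) (covers-at-tail e′ (valid-proper vp e′∈)))
        (covers-at-tail e (valid-proper vp e∈)))

  outStep-sink : ∀ {v p} j → ValidFrom F v p → outStep F p (snk j) ≡ nothing
  outStep-sink {p = p} j vp = findᵉ-none _ p (λ e e∈ → not-from-sink e (valid-proper vp e∈))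
    where
    not-from-sink : ∀ e → Proper e → (tail F e =ᵛ snk j) ≡ false
    not-from-sink (src _ , _) _ = refl
    not-from-sink (int _ , _) _ = refl

  inStep-nothing : ∀ {v p e} → ValidFrom F v p → e ∈ p → ∀ (w : Fin m) → Covers e (toℕ w) →
                   head F e ≢ int w → inStep F p (int w) ≡ nothing
  inStep-nothing {p = p} {e} vp e∈ w c he≢w = findᵉ-none _ p not-entering
    where
    not-entering : ∀ e′ → e′ ∈ p → (head F e′ =ᵛ int w) ≡ false
    not-entering e′ e′∈ with head F e′ =ᵛ int w in eq
    ... | false = refl
    ... | true with path-covers-unique vp e′∈ e∈ (entering-covers vp e′∈ (=ᵛ⇒≡ eq)) c
    ...   | refl = ⊥-elim (he≢w (=ᵛ⇒≡ eq))

  edge-after : ∀ {v p e k} → ValidFrom F v p → e ∈ p → head F e ≡ int k →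
               Σ (LE F) λ e′ → e′ ∈ p × tail F e′ ≡ int k
  edge-after {v} {p} {e} {k} vp e∈ he
    with path-covers {y = suc (toℕ k)} vp (<⇒≤ (subst (λ h → rank v < rank h) he (valid-head vp e∈)))
                     (s≤s (toℕ<n k))
  ... | e′ , e′∈ , t≤k+1 , k+1<h with m≤n⇒m<n∨m≡n t≤k+1
  ...   | inj₂ t≡k+1 = e′ , e′∈ , rank≡⇒int (tail F e′) k t≡k+1
  ...   | inj₁ t<k+1
    with path-covers-unique vp e′∈ e∈ (≤-pred t<k+1 , <-trans (n<1+n _) k+1<h) (entering-covers vp e∈ he)
  ...     | refl = ⊥-elim (<-irrefl (sym (cong rank he)) k+1<h)

  leaving-covers : ∀ {v p e k} → ValidFrom F v p → e ∈ p → tail F e ≡ int k → Covers e (suc (toℕ k))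
  leaving-covers {e = e} vp e∈ te =
    subst (λ t → rank t ≤ _) (sym te) ≤-refl ,
    subst (λ t → rank t < rank (head F e)) te (rank-tail<head e (valid-proper vp e∈))

  edge-before : ∀ {a p e k} → ValidFrom F (src a) p → e ∈ p → tail F e ≡ int k →
                Σ (LE F) λ e′ → e′ ∈ p × head F e′ ≡ int k
  edge-before {e = e} {k} vp e∈ te with path-covers {y = toℕ k} vp z≤n (<-trans (toℕ<n k) (n<1+n _))
  ... | e′ , e′∈ , t≤k , k<h with m≤n⇒m<n∨m≡n k<h
  ...   | inj₂ k+1≡h = e′ , e′∈ , rank≡⇒int (head F e′) k (sym k+1≡h)
  ...   | inj₁ k+1<h with path-covers-unique vp e′∈ e∈ (m≤n⇒m≤1+n t≤k , k+1<h) (leaving-covers vp e∈ te)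
  ...     | refl = ⊥-elim (<-irrefl refl (≤-trans (≤-reflexive (cong rank (sym te))) t≤k))

  edgeAt-after : ∀ {v p e} → ValidFrom F v p → e ∈ p → ∀ (w : Fin m) → head F e ≡ int w →
    Σ (LE F) λ e₁ → e₁ ∈ p × tail F e₁ ≡ int w × edgeAt p (suc (toℕ w)) ≡ just e₁
  edgeAt-after vp e∈ w he with edge-after vp e∈ he
  ... | e₁ , e₁∈ , te₁ = e₁ , e₁∈ , te₁ , edgeAt-covers vp e₁∈ (leaving-covers vp e₁∈ te₁)

  entering-edgeAt : ∀ {v p e k} → ValidFrom F v p → inStep F p (int k) ≡ just e →
                    edgeAt p (toℕ k) ≡ just e
  entering-edgeAt {p = p} {k = k} vp ie with inStep-just p (int k) ie
  ... | e∈ , he = edgeAt-covers vp e∈ (entering-covers vp e∈ he)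

  entering-lines-differ : ∀ {v w p q k e f} → ValidFrom F v p → ValidFrom F w q →
    inStep F p (int k) ≡ just e → inStep F q (int k) ≡ just f → sameEdge F e f ≡ false →
    toℕ (line F e) ≢ toℕ (line F f)
  entering-lines-differ {p = p} {q} {k} vp vq ie iq e≁f with inStep-just p (int k) ie | inStep-just q (int k) iq
  ... | e∈ , he | f∈ , hf =
    distinct-edges-distinct-lines (valid-proper vp e∈) (valid-proper vq f∈)
      (entering-covers vp e∈ he) (entering-covers vq f∈ hf) e≁f

  leaving-lines-differ : ∀ {v w p q c o o′} → ValidFrom F v p → ValidFrom F w q →
    outStep F p c ≡ just o → outStep F q c ≡ just o′ → sameEdge F o o′ ≡ false →
    toℕ (line F o) ≢ toℕ (line F o′)
  leaving-lines-differ {p = p} {q} {c} {o} {o′} vp vq op oq o≁o′ with outStep-just p c op | outStep-just q c oq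
  ... | o∈ , refl | o′∈ , to′ =
    distinct-edges-distinct-lines (valid-proper vp o∈) (valid-proper vq o′∈)
      (covers-at-tail o (valid-proper vp o∈))
      (subst (λ t → Covers o′ (rank t)) to′ (covers-at-tail o′ (valid-proper vq o′∈))) o≁o′

  meet⇒entering : ∀ p q j → meetᵇ F p q j ≡ true →
    Σ (LE F) λ e → Σ (LE F) λ f →
      inStep F p (int j) ≡ just e × inStep F q (int j) ≡ just f × sameEdge F e f ≡ false
  meet⇒entering p q j eq with inStep F p (int j) | inStep F q (int j)
  ... | just e | just f with sameEdge F e f in s
  ...   | false = e , f , refl , refl , s
  meet⇒entering p q j () | just e | just f | true
  meet⇒entering p q j () | just e | nothing
  meet⇒entering p q j () | nothing | _

  meet-entering : ∀ p q j {e f} → inStep F p (int j) ≡ just e → inStep F q (int j) ≡ just f →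
    meetᵇ F p q j ≡ not (sameEdge F e f)
  meet-entering p q j ie if with inStep F p (int j) | inStep F q (int j)
  meet-entering p q j refl refl | just e | just f = refl

  meet-apart : ∀ p q j {e f} → meetᵇ F p q j ≡ true →
               inStep F p (int j) ≡ just e → inStep F q (int j) ≡ just f → sameEdge F e f ≡ false
  meet-apart p q j {e} {f} meets ie iq with sameEdge F e f | trans (sym (meet-entering p q j ie iq)) meets
  ... | false | _ = refl

  meet-nothingˡ : ∀ p q j → inStep F p (int j) ≡ nothing → meetᵇ F p q j ≡ false
  meet-nothingˡ p q j ie with inStep F p (int j)
  meet-nothingˡ p q j refl | nothing = refl

  meet-nothingʳ : ∀ p q j → inStep F q (int j) ≡ nothing → meetᵇ F p q j ≡ false
  meet-nothingʳ p q j iq with inStep F p (int j) | inStep F q (int j)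
  meet-nothingʳ p q j refl | just e  | nothing = refl
  meet-nothingʳ p q j refl | nothing | nothing = refl

  ¬meet⇒¬cross : ∀ p q j → meetᵇ F p q j ≡ false → crossᵇ F p q j ≡ false
  ¬meet⇒¬cross p q j ¬meet with meetᵇ F p q j
  ¬meet⇒¬cross p q j refl | false = refl

  cross-entering-leaving : ∀ p q j {e f o o′} → meetᵇ F p q j ≡ true →
    inStep F p (int j) ≡ just e → inStep F q (int j) ≡ just f →
    outStep F p (compEnd F p q (int j)) ≡ just o → outStep F q (compEnd F p q (int j)) ≡ just o′ →
    crossᵇ F p q j ≡ ((toℕ (line F e) <ᵇ toℕ (line F f)) xor (toℕ (line F o) <ᵇ toℕ (line F o′)))
  cross-entering-leaving p q j meet ie if oe of
    with inStep F p (int j) | inStep F q (int j)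
       | outStep F p (compEnd F p q (int j)) | outStep F q (compEnd F p q (int j))
  cross-entering-leaving p q j meet refl refl refl refl | just e | just f | just o | just o′
    with sameEdge F e f
  ... | false = refl
  cross-entering-leaving p q j () refl refl refl refl | just e | just f | just o | just o′ | true

  cross⇒leaving : ∀ p q j → crossᵇ F p q j ≡ true →
    Σ (LE F) λ o → Σ (LE F) λ o′ →
      outStep F p (compEnd F p q (int j)) ≡ just o × outStep F q (compEnd F p q (int j)) ≡ just o′
  cross⇒leaving p q j cross
    with inStep F p (int j) | inStep F q (int j)
       | outStep F p (compEnd F p q (int j)) | outStep F q (compEnd F p q (int j))
  ... | just e  | just f  | just o  | just o′ = o , o′ , refl , refl
  cross⇒leaving p q j () | nothing | _ | _ | _
  cross⇒leaving p q j () | just _ | nothing | _ | _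
  cross⇒leaving p q j cross | just e | just f | nothing | _ with sameEdge F e f
  cross⇒leaving p q j () | just e | just f | nothing | _ | true
  cross⇒leaving p q j () | just e | just f | nothing | _ | false
  cross⇒leaving p q j cross | just e | just f | just _ | nothing with sameEdge F e f
  cross⇒leaving p q j () | just e | just f | just _ | nothing | true
  cross⇒leaving p q j () | just e | just f | just _ | nothing | false

  compEnd-separating : ∀ p q v {o o′} → outStep F p v ≡ just o → outStep F q v ≡ just o′ →
                       sameEdge F o o′ ≡ false → compEnd F p q v ≡ v
  compEnd-separating p q v oe of ¬same with outStep F p v | outStep F q v
  compEnd-separating p q v refl refl ¬same | just o | just o′ rewrite ¬same = refl

  -- Components of the intersection of two paths

  Entering : Path F → Vtx n m → Set
  Entering p c = Σ (LE F) λ o → o ∈ p × head F o ≡ c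

  module Component {vp vq : Vtx n m} {p q : Path F} (VP : ValidFrom F vp p) (VQ : ValidFrom F vq q) where

    Shared : ℕ → Set
    Shared y = Σ (LE F) λ e → Σ (LE F) λ e′ →
               edgeAt p y ≡ just e × edgeAt q y ≡ just e′ × sameEdge F e e′ ≡ true

    LeaveTogether : Vtx n m → Set
    LeaveTogether c = Σ (LE F) λ o → Σ (LE F) λ o′ →
                      outStep F p c ≡ just o × outStep F q c ≡ just o′ × sameEdge F o o′ ≡ true

    record Walk (v c : Vtx n m) : Set where
      field
        rank≤   : rank v ≤ rank c
        shared  : ∀ y → rank v ≤ y → y < rank c → Shared y
        entered : c ≡ v ⊎ (Entering p c × Entering q c)

    walk-refl : ∀ v → Walk v v
    walk-refl v = record
      { rank≤   = ≤-refl
      ; shared  = λ y v≤y y<v → ⊥-elim (<-irrefl refl (<-≤-trans y<v v≤y))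
      ; entered = inj₁ refl
      }

    walk-step : ∀ {v c o o′} → outStep F p v ≡ just o → outStep F q v ≡ just o′ →
                sameEdge F o o′ ≡ true → Walk (head F o) c → Walk v c
    walk-step {v} {c} {o} {o′} op oq o~o′ w = record
      { rank≤ = ≤-trans (<⇒≤ v<o) (Walk.rank≤ w) ; shared = shared ; entered = entered (Walk.entered w) }
      where
      o∈ = outStep-just p v op
      o′∈ = outStep-just q v oq
      v<o = outStep-advances VP op
      heads : head F o ≡ head F o′
      heads = sameEdge-head o o′ o~o′
      shared : ∀ y → rank v ≤ y → y < rank c → Shared y
      shared y v≤y y<c with <-cmp y (rank (head F o))
      ... | tri< y<o _ _ =
        o , o′ , edgeAt-covers VP (proj₁ o∈) (subst (λ t → rank t ≤ y) (sym (proj₂ o∈)) v≤y , y<o) ,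
                 edgeAt-covers VQ (proj₁ o′∈) (subst (λ t → rank t ≤ y) (sym (proj₂ o′∈)) v≤y ,
                                               subst (λ h → y < rank h) heads y<o) , o~o′
      ... | tri≈ _ y≡o _ = Walk.shared w y (≤-reflexive (sym y≡o)) y<c
      ... | tri> _ _ o<y = Walk.shared w y (<⇒≤ o<y) y<c
      entered : c ≡ head F o ⊎ (Entering p c × Entering q c) → c ≡ v ⊎ (Entering p c × Entering q c)
      entered (inj₁ c≡o) =
        inj₂ ((o , proj₁ o∈ , sym c≡o) , (o′ , proj₁ o′∈ , trans (sym heads) (sym c≡o)))
      entered (inj₂ both) = inj₂ both

    walk : ∀ f v → Walk v (compEndFuel F f p q v)
    walk zero v = walk-refl v
    walk (suc f) v with outStep F p v in op | outStep F q v in oq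
    ... | nothing | _       = walk-refl v
    ... | just o  | nothing = walk-refl v
    ... | just o  | just o′ with sameEdge F o o′ in o~o′
    ...   | false = walk-refl v
    ...   | true  = walk-step op oq o~o′ (walk f (head F o))

    walk-stops : ∀ f v → suc m ∸ rank v ≤ f → ¬ LeaveTogether (compEndFuel F f p q v)
    walk-stops zero (snk j) _ (o , _ , op , _) with trans (sym op) (outStep-sink j VP)
    ... | ()
    walk-stops zero (int k) f≥ _ = <⇒≱ (toℕ<n k) (m∸n≡0⇒m≤n (n≤0⇒n≡0 f≥))
    walk-stops (suc f) v f≥ with outStep F p v in op | outStep F q v in oq
    ... | nothing | _ = λ { (_ , _ , op′ , _) → nothing≢just (trans (sym op) op′) }
    ... | just o  | nothing = λ { (_ , _ , _ , oq′ , _) → nothing≢just (trans (sym oq) oq′) }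
    ... | just o  | just o′ with sameEdge F o o′ in o~o′
    ...   | false = λ { (_ , _ , op′ , oq′ , o~o₁) → separate (trans (sym op) op′) (trans (sym oq) oq′) o~o₁ }
      where
      separate : ∀ {o₁ o₁′} → just o ≡ just o₁ → just o′ ≡ just o₁′ → sameEdge F o₁ o₁′ ≢ true
      separate refl refl o~o₁ = true≢false (trans (sym o~o₁) o~o′)
    ...   | true =
      walk-stops f (head F o)
        (≤-pred (<-≤-trans (∸-monoʳ-< (outStep-advances VP op) (rank≤1+m (head F o))) f≥))

  -- Parity of crossings

  oddᵇ-+-bit : ∀ c b → oddᵇ F (c + (if b then 1 else 0)) ≡ (oddᵇ F c xor b)
  oddᵇ-+-bit c true rewrite +-comm c 1 with oddᵇ F c
  ... | true  = refl
  ... | false = refl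
  oddᵇ-+-bit c false rewrite +-identityʳ c with oddᵇ F c
  ... | true  = refl
  ... | false = refl

  passing-offLine : ∀ w {f} → Proper f → Covers f (toℕ w) → Covers f (suc (toℕ w)) →
                    onLineᵇ F w (line F f) ≡ false
  passing-offLine w {f} pf cw cw+1 with onLineᵇ F w (line F f) in on
  ... | true  =
    ⊥-elim (<-irrefl refl (<-≤-trans (proj₂ cw+1) (next-minimal (line F f) (tail F f) w on (s≤s (proj₁ cw)))))
  ... | false = refl

  passing⇒not-entering : ∀ {e} w → Covers e (suc (toℕ w)) → head F e ≢ int w
  passing⇒not-entering w (_ , w<h) he = <-irrefl (sym (cong rank he)) w<h

  entering-apart : ∀ e f {w} → head F e ≡ int w → head F f ≢ int w → sameEdge F e f ≡ false
  entering-apart e f he hf = ¬-not (λ e~f → hf (trans (sym (sameEdge-head e f e~f)) he))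

  leaving-apart : ∀ e f w → tail F e ≡ int w → Covers f (toℕ w) → sameEdge F e f ≡ false
  leaving-apart e f w te (t≤w , _) =
    ¬-not (λ e~f → <-irrefl refl (subst (_≤ toℕ w) (cong rank (trans (sym (sameEdge-tail e f e~f)) te)) t≤w))

  leaving-onLine : ∀ {e w} → Proper e → tail F e ≡ int w → onLineᵇ F w (line F e) ≡ true
  leaving-onLine {e} pe te = subst (λ t → onLineVᵇ F (line F e) t ≡ true) te pe

  module Parity {a b : Fin n} {p q : Path F}
                (VP : ValidFrom F (src a) p) (VQ : ValidFrom F (src b) q) (a<b : toℕ a < toℕ b) where
    open Component VP VQ

    crossings : ℕ → ℕ
    crossings y = length (filterᵇ (λ j → (toℕ j <ᵇ y) ∧ crossᵇ F p q j) (allFin m))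

    crossings-step : ∀ (w : Fin m) →
                     crossings (suc (toℕ w)) ≡ crossings (toℕ w) + (if crossᵇ F p q w then 1 else 0)
    crossings-step w = trans (count-below-suc (crossᵇ F p q) (toℕ w) (allFin m))
                             (cong (crossings (toℕ w) +_) (count-at (crossᵇ F p q) w))

    parity-step : ∀ (w : Fin m) →
                  oddᵇ F (crossings (suc (toℕ w))) ≡ (oddᵇ F (crossings (toℕ w)) xor crossᵇ F p q w)
    parity-step w = trans (cong (oddᵇ F) (crossings-step w)) (oddᵇ-+-bit (crossings (toℕ w)) (crossᵇ F p q w))

    crossings-no-cross : ∀ (w : Fin m) → crossᵇ F p q w ≡ false → crossings (suc (toℕ w)) ≡ crossings (toℕ w)
    crossings-no-cross w ¬cross =
      trans (crossings-step w) (trans (cong (λ c → crossings (toℕ w) + (if c then 1 else 0)) ¬cross)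
                                      (+-identityʳ _))

    parity-no-cross : ∀ (w : Fin m) → crossᵇ F p q w ≡ false →
                      oddᵇ F (crossings (toℕ w)) ≡ oddᵇ F (crossings (suc (toℕ w)))
    parity-no-cross w ¬cross = cong (oddᵇ F) (sym (crossings-no-cross w ¬cross))

    below : LE F → LE F → Bool
    below e f = toℕ (line F f) <ᵇ toℕ (line F e)

    -- Invariant of the sweep: on a strip where p and q use different edges, q is below p iff an odd number
    -- of crossings lie to the left; on a shared strip, the component of p ∩ q through it started at a
    -- meeting whose entry order obeyed this rule.
    Apart : ℕ → Set
    Apart y = ∀ e f → edgeAt p y ≡ just e → edgeAt q y ≡ just f → sameEdge F e f ≡ false →
              below e f ≡ oddᵇ F (crossings y)

    record OpenComponent (y : ℕ) : Set where
      field
        start       : Fin m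
        start<y     : toℕ start < y
        meets       : meetᵇ F p q start ≡ true
        no-crossing : crossings y ≡ crossings (suc (toℕ start))
        shared      : ∀ y′ → suc (toℕ start) ≤ y′ → y′ ≤ y → Shared y′
        entry-order : ∀ e f → inStep F p (int start) ≡ just e → inStep F q (int start) ≡ just f →
                      below e f ≡ oddᵇ F (crossings (toℕ start))

    Together : ℕ → Set
    Together y = ∀ e f → edgeAt p y ≡ just e → edgeAt q y ≡ just f → sameEdge F e f ≡ true → OpenComponent y

    Invariant : ℕ → Set
    Invariant y = Apart y × Together y

    apart-at : ∀ {y e f} → edgeAt p y ≡ just e → edgeAt q y ≡ just f →
               (sameEdge F e f ≡ false → below e f ≡ oddᵇ F (crossings y)) → Apart y
    apart-at pe qf h e′ f′ pe′ qf′ with trans (sym pe) pe′ | trans (sym qf) qf′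
    ... | refl | refl = h

    together-at : ∀ {y e f} → edgeAt p y ≡ just e → edgeAt q y ≡ just f →
                  (sameEdge F e f ≡ true → OpenComponent y) → Together y
    together-at pe qf h e′ f′ pe′ qf′ with trans (sym pe) pe′ | trans (sym qf) qf′
    ... | refl | refl = h

    apart⇒¬shared : ∀ {y e f} → edgeAt p y ≡ just e → edgeAt q y ≡ just f → sameEdge F e f ≡ false →
                    ¬ Shared y
    apart⇒¬shared pe qf ¬same (e′ , f′ , pe′ , qf′ , same′) with trans (sym pe) pe′ | trans (sym qf) qf′
    ... | refl | refl = true≢false (trans (sym same′) ¬same)

    meet⇒both-enter : ∀ {j} → meetᵇ F p q j ≡ true → Entering p (int j) × Entering q (int j)
    meet⇒both-enter {j} meets with meet⇒entering p q j meets
    ... | e , f , ie , iq , _ = (e , inStep-just p (int j) ie) , (f , inStep-just q (int j) iq)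

    -- The walk along common edges from x_j stops neither before x_w (all strips up to w are shared, so the
    -- paths leave every earlier vertex together) nor after it (strip w + 1 is not shared).
    component-end : ∀ (j w : Fin m) → toℕ j < toℕ w → meetᵇ F p q j ≡ true →
      (∀ y → suc (toℕ j) ≤ y → y ≤ toℕ w → Shared y) → ¬ Shared (suc (toℕ w)) →
      compEnd F p q (int j) ≡ int w
    component-end j w j<w meets shared ¬shared =
      end-is-w (compEnd F p q (int j)) (walk (suc m) (int j))
               (walk-stops (suc m) (int j) (m∸n≤m (suc m) (suc (toℕ j))))
      where
      both-enter : ∀ {c} → Walk (int j) c → Entering p c × Entering q c
      both-enter wk with Walk.entered wk
      ... | inj₁ refl = meet⇒both-enter meets
      ... | inj₂ both = both
      end-is-w : ∀ c → Walk (int j) c → ¬ LeaveTogether c → c ≡ int w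
      end-is-w c wk apart with <-cmp (rank c) (suc (toℕ w))
      ... | tri≈ _ c≡w _ = rank≡⇒int c w c≡w
      ... | tri> _ _ w<c = ⊥-elim (¬shared (Walk.shared wk (suc (toℕ w)) (s≤s (<⇒≤ j<w)) w<c))
      end-is-w (src _) wk apart | tri< _ _ _ = ⊥-elim (n≮0 (Walk.rank≤ wk))
      end-is-w (snk _) wk apart | tri< m<w _ _ = ⊥-elim (<-asym (toℕ<n w) (≤-pred m<w))
      end-is-w (int c) wk apart | tri< c<w _ _
        with shared (suc (toℕ c)) (Walk.rank≤ wk) (≤-pred c<w) | both-enter wk
      ... | e , f , pe , qf , e~f | (o , o∈ , ho) , (o′ , o′∈ , ho′)
        with edge-after VP o∈ ho | edge-after VQ o′∈ ho′
      ... | (l , l∈ , tl) | (l′ , l′∈ , tl′)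
        with trans (sym (edgeAt-covers VP l∈ (leaving-covers VP l∈ tl))) pe
           | trans (sym (edgeAt-covers VQ l′∈ (leaving-covers VQ l′∈ tl′))) qf
      ... | refl | refl = ⊥-elim (apart (l , l′ , outStep-leaving VP l∈ tl , outStep-leaving VQ l′∈ tl′ , e~f))

    exit-order : ∀ j {e f o o′ c} → meetᵇ F p q j ≡ true →
      inStep F p (int j) ≡ just e → inStep F q (int j) ≡ just f →
      outStep F p (compEnd F p q (int j)) ≡ just o → outStep F q (compEnd F p q (int j)) ≡ just o′ →
      sameEdge F o o′ ≡ false → below e f ≡ c → below o o′ ≡ (c xor crossᵇ F p q j)
    exit-order j {e} {f} {o} {o′} {c} meets ie iq op oq o≁o′ entry =
      xor-order (below e f) (below o o′) c (crossᵇ F p q j) entry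
        (trans (cross-entering-leaving p q j meets ie iq op oq)
               (cong₂ _xor_ (<ᵇ-flip (entering-lines-differ VP VQ ie iq (meet-apart p q j meets ie iq)))
                            (<ᵇ-flip (leaving-lines-differ VP VQ op oq o≁o′))))

    extend : ∀ (w : Fin m) → crossᵇ F p q w ≡ false → Shared (suc (toℕ w)) →
             OpenComponent (toℕ w) → OpenComponent (suc (toℕ w))
    extend w ¬cross shared-w+1 oc = record
      { start       = start
      ; start<y     = m<n⇒m<1+n start<y
      ; meets       = meets
      ; no-crossing = trans (crossings-no-cross w ¬cross) no-crossing
      ; shared      = shared′
      ; entry-order = entry-order
      }
      where
      open OpenComponent oc
      shared′ : ∀ y → suc (toℕ start) ≤ y → y ≤ suc (toℕ w) → Shared y
      shared′ y lo hi with m≤n⇒m<n∨m≡n hi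
      ... | inj₁ y<w+1 = shared y lo (≤-pred y<w+1)
      ... | inj₂ refl  = shared-w+1

    step-passing : ∀ w {e f} → e ∈ p → f ∈ q → Covers e (toℕ w) → Covers f (toℕ w) →
      Covers e (suc (toℕ w)) → Covers f (suc (toℕ w)) → Invariant (toℕ w) → Invariant (suc (toℕ w))
    step-passing w {e} {f} e∈ f∈ ce cf ce′ cf′ (apart , together) =
      apart-at pe′ qf′ (λ e≁f → trans (apart e f pe qf e≁f) (parity-no-cross w ¬cross)) ,
      together-at pe′ qf′ (λ e~f → extend w ¬cross (e , f , pe′ , qf′ , e~f) (together e f pe qf e~f))
      where
      pe = edgeAt-covers VP e∈ ce
      qf = edgeAt-covers VQ f∈ cf
      pe′ = edgeAt-covers VP e∈ ce′
      qf′ = edgeAt-covers VQ f∈ cf′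
      ¬cross = ¬meet⇒¬cross p q w (meet-nothingˡ p q w (inStep-nothing VP e∈ w ce (passing⇒not-entering w ce′)))

    step-p-visits : ∀ w {e f} → e ∈ p → f ∈ q → Covers e (toℕ w) → Covers f (toℕ w) →
      head F e ≡ int w → Covers f (suc (toℕ w)) → Invariant (toℕ w) → Invariant (suc (toℕ w))
    step-p-visits w {e} {f} e∈ f∈ ce cf he cf′ (apart , _) with edgeAt-after VP e∈ w he
    ... | e₁ , e₁∈ , te₁ , pe₁ =
      apart-at pe₁ qf′ (λ _ → trans same-side (trans (apart e f pe qf e≁f) (parity-no-cross w ¬cross))) ,
      together-at pe₁ qf′ (λ e₁~f → ⊥-elim (true≢false (trans (sym e₁~f) (leaving-apart e₁ f w te₁ cf))))
      where
      pe = edgeAt-covers VP e∈ ce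
      qf = edgeAt-covers VQ f∈ cf
      qf′ = edgeAt-covers VQ f∈ cf′
      ¬cross = ¬meet⇒¬cross p q w (meet-nothingʳ p q w (inStep-nothing VQ f∈ w cf (passing⇒not-entering w cf′)))
      e≁f = entering-apart e f he (passing⇒not-entering w cf′)
      same-side : below e₁ f ≡ below e f
      same-side = offLine-side w (leaving-onLine (valid-proper VP e₁∈) te₁) (next-onLine (line F e) (tail F e) he)
                    (passing-offLine w (valid-proper VQ f∈) cf cf′)

    step-q-visits : ∀ w {e f} → e ∈ p → f ∈ q → Covers e (toℕ w) → Covers f (toℕ w) →
      Covers e (suc (toℕ w)) → head F f ≡ int w → Invariant (toℕ w) → Invariant (suc (toℕ w))
    step-q-visits w {e} {f} e∈ f∈ ce cf ce′ hf (apart , _) with edgeAt-after VQ f∈ w hf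
    ... | f₁ , f₁∈ , tf₁ , qf₁ =
      apart-at pe′ qf₁ (λ _ → trans same-side (trans (apart e f pe qf e≁f) (parity-no-cross w ¬cross))) ,
      together-at pe′ qf₁
        (λ e~f₁ → ⊥-elim (true≢false (trans (sym e~f₁)
                                             (sameEdge-sym-false f₁ e (leaving-apart f₁ e w tf₁ ce)))))
      where
      pe = edgeAt-covers VP e∈ ce
      qf = edgeAt-covers VQ f∈ cf
      pe′ = edgeAt-covers VP e∈ ce′
      ¬cross = ¬meet⇒¬cross p q w (meet-nothingˡ p q w (inStep-nothing VP e∈ w ce (passing⇒not-entering w ce′)))
      e≁f = sameEdge-sym-false f e (entering-apart f e hf (passing⇒not-entering w ce′))
      same-side : below e f₁ ≡ below e f
      same-side = offLine-side′ w (leaving-onLine (valid-proper VQ f₁∈) tf₁) (next-onLine (line F f) (tail F f) hf)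
                    (passing-offLine w (valid-proper VP e∈) ce ce′)

    module BothVisit (w : Fin m) {e f e₁ f₁ : LE F} (e∈ : e ∈ p) (f∈ : f ∈ q)
                     (ce : Covers e (toℕ w)) (cf : Covers f (toℕ w))
                     (he : head F e ≡ int w) (hf : head F f ≡ int w)
                     (e₁∈ : e₁ ∈ p) (te₁ : tail F e₁ ≡ int w) (pe₁ : edgeAt p (suc (toℕ w)) ≡ just e₁)
                     (f₁∈ : f₁ ∈ q) (tf₁ : tail F f₁ ≡ int w) (qf₁ : edgeAt q (suc (toℕ w)) ≡ just f₁)
                     (inv : Invariant (toℕ w)) where
      pe : edgeAt p (toℕ w) ≡ just e
      pe = edgeAt-covers VP e∈ ce
      qf : edgeAt q (toℕ w) ≡ just f
      qf = edgeAt-covers VQ f∈ cf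
      ie : inStep F p (int w) ≡ just e
      ie = inStep-entering VP e∈ he
      iq : inStep F q (int w) ≡ just f
      iq = inStep-entering VQ f∈ hf
      op : outStep F p (int w) ≡ just e₁
      op = outStep-leaving VP e₁∈ te₁
      oq : outStep F q (int w) ≡ just f₁
      oq = outStep-leaving VQ f₁∈ tf₁

      leaving-from : ∀ {c} → compEnd F p q c ≡ int w →
                     outStep F p (compEnd F p q c) ≡ just e₁ × outStep F q (compEnd F p q c) ≡ just f₁
      leaving-from end = subst (λ c → outStep F p c ≡ just e₁) (sym end) op ,
                         subst (λ c → outStep F q c ≡ just f₁) (sym end) oq

      cross-point : sameEdge F e f ≡ false → sameEdge F e₁ f₁ ≡ false → Invariant (suc (toℕ w))
      cross-point e≁f e₁≁f₁ =
        apart-at pe₁ qf₁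
          (λ _ → trans (exit-order w meets ie iq (proj₁ out) (proj₂ out) e₁≁f₁ (proj₁ inv e f pe qf e≁f))
                       (sym (parity-step w))) ,
        together-at pe₁ qf₁ (λ e₁~f₁ → ⊥-elim (true≢false (trans (sym e₁~f₁) e₁≁f₁)))
        where
        meets = trans (meet-entering p q w ie iq) (cong not e≁f)
        out = leaving-from (compEnd-separating p q (int w) op oq e₁≁f₁)

      join : sameEdge F e f ≡ false → sameEdge F e₁ f₁ ≡ true → Invariant (suc (toℕ w))
      join e≁f e₁~f₁ =
        apart-at pe₁ qf₁ (λ e₁≁f₁ → ⊥-elim (true≢false (trans (sym e₁~f₁) e₁≁f₁))) ,
        together-at pe₁ qf₁ (λ _ → record
          { start       = w
          ; start<y     = n<1+n (toℕ w)
          ; meets       = trans (meet-entering p q w ie iq) (cong not e≁f)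
          ; no-crossing = refl
          ; shared      = λ y lo hi → subst Shared (≤-antisym lo hi) (e₁ , f₁ , pe₁ , qf₁ , e₁~f₁)
          ; entry-order = λ e′ f′ ie′ iq′ → entry (trans (sym ie) ie′) (trans (sym iq) iq′)
          })
        where
        entry : ∀ {e′ f′} → just e ≡ just e′ → just f ≡ just f′ →
                below e′ f′ ≡ oddᵇ F (crossings (toℕ w))
        entry refl refl = proj₁ inv e f pe qf e≁f

      stay : sameEdge F e f ≡ true → sameEdge F e₁ f₁ ≡ true → Invariant (suc (toℕ w))
      stay e~f e₁~f₁ =
        apart-at pe₁ qf₁ (λ e₁≁f₁ → ⊥-elim (true≢false (trans (sym e₁~f₁) e₁≁f₁))) ,
        together-at pe₁ qf₁
          (λ _ → extend w ¬cross (e₁ , f₁ , pe₁ , qf₁ , e₁~f₁) (proj₂ inv e f pe qf e~f))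
        where
        ¬cross = ¬meet⇒¬cross p q w (trans (meet-entering p q w ie iq) (cong not e~f))

      leave : sameEdge F e f ≡ true → sameEdge F e₁ f₁ ≡ false → Invariant (suc (toℕ w))
      leave e~f e₁≁f₁ =
        apart-at pe₁ qf₁ (λ _ → exit) ,
        together-at pe₁ qf₁ (λ e₁~f₁ → ⊥-elim (true≢false (trans (sym e₁~f₁) e₁≁f₁)))
        where
        open OpenComponent (proj₂ inv e f pe qf e~f)
        ¬cross = ¬meet⇒¬cross p q w (trans (meet-entering p q w ie iq) (cong not e~f))
        out = leaving-from (component-end start w start<y meets shared (apart⇒¬shared pe₁ qf₁ e₁≁f₁))
        -- the component of p ∩ q that started at x_start ends at x_w, and no crossing lies in between
        exit : below e₁ f₁ ≡ oddᵇ F (crossings (suc (toℕ w)))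
        exit with meet⇒entering p q start meets
        ... | e₀ , f₀ , ie₀ , iq₀ , _ =
          trans (exit-order start meets ie₀ iq₀ (proj₁ out) (proj₂ out) e₁≁f₁
                            (entry-order e₀ f₀ ie₀ iq₀))
                (sym (trans (cong (oddᵇ F) (trans (crossings-no-cross w ¬cross) no-crossing)) (parity-step start)))

      step : Invariant (suc (toℕ w))
      step with sameEdge F e f in e~f | sameEdge F e₁ f₁ in e₁~f₁
      ... | false | false = cross-point e~f e₁~f₁
      ... | false | true  = join e~f e₁~f₁
      ... | true  | true  = stay e~f e₁~f₁
      ... | true  | false = leave e~f e₁~f₁

    step : ∀ (w : Fin m) → Invariant (toℕ w) → Invariant (suc (toℕ w))
    step w inv with path-covers VP z≤n (m<n⇒m<1+n (toℕ<n w)) | path-covers VQ z≤n (m<n⇒m<1+n (toℕ<n w))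
    ... | e , e∈ , ce | f , f∈ , cf with covers-step e w ce | covers-step f w cf
    ...   | inj₂ ce′ | inj₂ cf′ = step-passing w e∈ f∈ ce cf ce′ cf′ inv
    ...   | inj₁ he  | inj₂ cf′ = step-p-visits w e∈ f∈ ce cf he cf′ inv
    ...   | inj₂ ce′ | inj₁ hf  = step-q-visits w e∈ f∈ ce cf ce′ hf inv
    ...   | inj₁ he  | inj₁ hf
      with edgeAt-after VP e∈ w he | edgeAt-after VQ f∈ w hf
    ...     | e₁ , e₁∈ , te₁ , pe₁ | f₁ , f₁∈ , tf₁ , qf₁ =
      BothVisit.step w e∈ f∈ ce cf he hf e₁∈ te₁ pe₁ f₁∈ tf₁ qf₁ inv

    invariant-start : Invariant 0
    invariant-start =
      apart-at (edgeAt-zero VP) (edgeAt-zero VQ)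
        (λ _ → trans (≮⇒<ᵇ≡false (<⇒≯ a<b)) (cong (oddᵇ F) (sym (length-filterᵇ-false (allFin m))))) ,
      together-at (edgeAt-zero VP) (edgeAt-zero VQ)
        (λ a~b → ⊥-elim (<-irrefl (cong toℕ (=ᶠ⇒≡ {i = a} {b} (∧≡true⇒ˡ a~b))) a<b))

    invariant : ∀ y → y ≤ m → Invariant y
    invariant zero    _     = invariant-start
    invariant (suc y) y<m =
      subst (Invariant ∘ suc) (toℕ-fromℕ< y<m)
            (step w (subst Invariant (sym (toℕ-fromℕ< y<m)) (invariant y (<⇒≤ y<m))))
      where w = fromℕ< y<m

    parity : ∀ (k : Fin m) {e f} → meetᵇ F p q k ≡ true →
             inStep F p (int k) ≡ just e → inStep F q (int k) ≡ just f →
             oddᵇ F (crossingsBefore F p q k) ≡ below e f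
    parity k meets ie iq =
      sym (proj₁ (invariant (toℕ k) (<⇒≤ (toℕ<n k))) _ _ (entering-edgeAt VP ie) (entering-edgeAt VQ iq)
                 (meet-apart p q k meets ie iq))

  -- Splicing

  Segment : Vtx n m → Vtx n m → Path F → Set
  Segment v u []       = v ≡ u
  Segment v u (e ∷ es) = tail F e ≡ v × onLineVᵇ F (line F e) v ≡ true × Segment (head F e) u es

  Segment-++ : ∀ {v u xs ys} → Segment v u xs → ValidFrom F u ys → ValidFrom F v (xs ++ ys)
  Segment-++ {xs = []}     refl           vy = vy
  Segment-++ {xs = _ ∷ _} (te , on , seg) vy = te , on , Segment-++ seg vy

  split-at : ∀ {v p e} (u : Fin m) → ValidFrom F v p → e ∈ p → head F e ≡ int u →
             Segment v (int u) (upTo F (int u) p) × ValidFrom F (int u) (fromV F (int u) p)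
  split-at {v} {e₀ ∷ es} u (refl , on₀ , vp) e∈ he with head F e₀ =ᵛ int u in h₀
  ... | true
    rewrite =ᵛ-≢ {v = v} {int u}
              (rank<⇒≢ (subst (λ h → rank v < rank h) (=ᵛ⇒≡ h₀) (rank-next (line F e₀) v on₀))) =
    (refl , on₀ , =ᵛ⇒≡ h₀) , from-u es (subst (λ h → ValidFrom F h es) (=ᵛ⇒≡ h₀) vp)
    where
    from-u : ∀ es → ValidFrom F (int u) es → ValidFrom F (int u) (fromV F (int u) es)
    from-u ((_ , _) ∷ _) (refl , on , vp) rewrite =ᵛ-refl {n} (int u) = refl , on , vp
  split-at {v} {e₀ ∷ es} u (refl , on₀ , vp) (here refl) he | false =
    ⊥-elim (true≢false (trans (sym (trans (cong (_=ᵛ int u) he) (=ᵛ-refl {n} (int u)))) h₀))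
  split-at {v} {e₀ ∷ es} {e} u (refl , on₀ , vp) (there e∈) he | false
    rewrite =ᵛ-≢ {v = v} {int u}
              (rank<⇒≢ (<-trans (rank-next (line F e₀) v on₀)
                                (subst (λ h → _ < rank h) he (valid-head vp e∈)))) =
    map₁ (λ seg → refl , on₀ , seg) (split-at u vp e∈ he)

  ∈-fromV : ∀ {v p e e′} (u : Fin m) → ValidFrom F v p → e′ ∈ p → tail F e′ ≡ int u →
            e ∈ p → rank {n} (int u) ≤ rank (tail F e) → e ∈ fromV F (int u) p
  ∈-fromV {v} {e₀ ∷ es} u (refl , on₀ , vp) e′∈ te′ e∈ u≤e with v =ᵛ int u in v≡u
  ... | true = e∈
  ∈-fromV {v} {e₀ ∷ es} u (refl , on₀ , vp) (here refl) te′ e∈ u≤e | false =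
    ⊥-elim (true≢false (trans (sym (trans (cong (_=ᵛ int u) te′) (=ᵛ-refl {n} (int u)))) v≡u))
  ∈-fromV {v} {e₀ ∷ es} u (refl , on₀ , vp) (there e′∈) te′ (here refl) u≤e | false =
    ⊥-elim (<-irrefl refl (≤-trans (<-≤-trans (rank-next (line F e₀) v on₀) (proj₂ (valid-∈ vp e′∈)))
                                    (subst (λ t → rank t ≤ rank v) (sym te′) u≤e)))
  ∈-fromV {v} {e₀ ∷ es} u (refl , on₀ , vp) (there e′∈) te′ (there e∈) u≤e | false =
    ∈-fromV u vp e′∈ te′ e∈ u≤e

  ∈-upTo : ∀ {v p e e′} (u : Fin m) → ValidFrom F v p → e′ ∈ p → head F e′ ≡ int u →
           e ∈ p → rank (head F e) ≤ rank {n} (int u) → e ∈ upTo F (int u) p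
  ∈-upTo {v} {e₀ ∷ es} u (refl , on₀ , vp) e′∈ he′ e∈ e≤u with head F e₀ =ᵛ int u in h₀
  ∈-upTo u (refl , on₀ , vp) e′∈ he′ (here refl) e≤u | true = here refl
  ∈-upTo {e = e} u (refl , on₀ , vp) e′∈ he′ (there e∈) e≤u | true =
    ⊥-elim (<-irrefl refl
      (<-≤-trans (subst (λ h → rank h < rank (head F e)) (=ᵛ⇒≡ h₀) (valid-head vp e∈)) e≤u))
  ∈-upTo u (refl , on₀ , vp) e′∈ he′ (here refl) e≤u | false = here refl
  ∈-upTo u (refl , on₀ , vp) (here refl) he′ (there e∈) e≤u | false =
    ⊥-elim (true≢false (trans (sym (trans (cong (_=ᵛ int u) he′) (=ᵛ-refl {n} (int u)))) h₀))
  ∈-upTo u (refl , on₀ , vp) (there e′∈) he′ (there e∈) e≤u | false =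
    there (∈-upTo u vp e′∈ he′ e∈ e≤u)

  splice-valid : ∀ {a b p q fk} (ℓ k : Fin m) → ValidFrom F (src a) p → ValidFrom F (src b) q →
    toℕ ℓ < toℕ k → Entering p (int ℓ) → Entering q (int ℓ) → Entering p (int k) →
    inStep F q (int k) ≡ just fk →
    ValidFrom F (src a) (splice F (int ℓ) (int k) p q) ×
    inStep F (splice F (int ℓ) (int k) p q) (int k) ≡ just fk
  splice-valid {p = p} {q} {fk} ℓ k vp vq ℓ<k (_ , eℓ∈ , heℓ) (_ , fℓ∈ , hfℓ) (_ , ek∈ , hek) iq
    with inStep-just q (int k) iq | edge-after vq fℓ∈ hfℓ
  ... | fk∈ , hfk | o , o∈ , to = valid , inStep-entering valid fk∈splice hfk
    where
    q-from-ℓ = proj₂ (split-at ℓ vq fℓ∈ hfℓ)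
    -- q leaves x_ℓ before it reaches x_k
    ℓ≤fk : rank {n} (int ℓ) ≤ rank (tail F fk)
    ℓ≤fk with <-cmp (rank (tail F fk)) (rank {n} (int ℓ))
    ... | tri> _ _ ℓ<fk = <⇒≤ ℓ<fk
    ... | tri≈ _ fk≡ℓ _ = ≤-reflexive (sym fk≡ℓ)
    ... | tri< fk<ℓ _ _ with path-covers-unique vq fk∈ o∈
                               (<⇒≤ fk<ℓ , subst (λ h → suc (toℕ ℓ) < rank h) (sym hfk) (s≤s ℓ<k))
                               (leaving-covers vq o∈ to)
    ...   | refl = ⊥-elim (<-irrefl (cong rank to) fk<ℓ)
    fk∈from-ℓ = ∈-fromV ℓ vq o∈ to fk∈ ℓ≤fk
    valid = Segment-++ (proj₁ (split-at ℓ vp eℓ∈ heℓ))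
              (Segment-++ (proj₁ (split-at k q-from-ℓ fk∈from-ℓ hfk)) (proj₂ (split-at k vp ek∈ hek)))
    fk∈splice : fk ∈ splice F (int ℓ) (int k) p q
    fk∈splice = ∈-++⁺ʳ (upTo F (int ℓ) p)
                  (∈-++⁺ˡ (∈-upTo k q-from-ℓ fk∈from-ℓ hfk fk∈from-ℓ (≤-reflexive (cong rank hfk))))

  cross-end-entered : ∀ {a b p q j ℓ} → ValidFrom F (src a) p → ValidFrom F (src b) q →
                      crossᵇ F p q j ≡ true → compEnd F p q (int j) ≡ int ℓ →
                      Entering p (int ℓ) × Entering q (int ℓ)
  cross-end-entered {p = p} {q} {j} {ℓ} vp vq crosses ends with cross⇒leaving p q j crosses
  ... | o , o′ , op , oq
    with outStep-just p (int ℓ) (subst (λ c → outStep F p c ≡ just o) ends op)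
       | outStep-just q (int ℓ) (subst (λ c → outStep F q c ≡ just o′) ends oq)
  ...   | o∈ , to | o′∈ , to′ = edge-before vp o∈ to , edge-before vq o′∈ to′

  -- Defects at x_k and the preimages under ψ

  Valid : Family F → Set
  Valid π = ∀ x → ValidFrom F (src x) (π x)

  module _ {π : Family F} (Vπ : Valid π) (k : Fin m) where

    defect⇒ : ∀ {i j ei ej} → Defect F π i j k →
              inStep F (π i) (int k) ≡ just ei → inStep F (π j) (int k) ≡ just ej →
              sameEdge F ei ej ≡ false × toℕ (line F ej) < toℕ (line F ei)
    defect⇒ {i} {j} (i<j , meets , odd) ii ij =
      meet-apart (π i) (π j) k meets ii ij ,
      <ᵇ≡true⇒< (trans (sym (Parity.parity (Vπ i) (Vπ j) i<j k meets ii ij)) odd)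

    defect⇐ : ∀ {i j ei ej} → toℕ i < toℕ j →
              inStep F (π i) (int k) ≡ just ei → inStep F (π j) (int k) ≡ just ej →
              sameEdge F ei ej ≡ false → toℕ (line F ej) < toℕ (line F ei) → Defect F π i j k
    defect⇐ {i} {j} i<j ii ij ei≁ej ej<ei =
      i<j , meets , trans (Parity.parity (Vπ i) (Vπ j) i<j k meets ii ij) (<⇒<ᵇ≡true ej<ei)
      where meets = trans (meet-entering (π i) (π j) k ii ij) (cong not ei≁ej)

  Prec-intro : ∀ p q k {e f} → inStep F p (int k) ≡ just e → inStep F q (int k) ≡ just f →
               sameEdge F e f ≡ false → toℕ (line F e) < toℕ (line F f) → Prec F p q k
  Prec-intro p q k ip iq e≁f e<f rewrite ip | iq = e≁f , e<f

  Prec-elim : ∀ p q k {e f} → Prec F p q k → inStep F p (int k) ≡ just e → inStep F q (int k) ≡ just f →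
              sameEdge F e f ≡ false × toℕ (line F e) < toℕ (line F f)
  Prec-elim p q k p≺q ip iq with inStep F p (int k) | inStep F q (int k)
  Prec-elim p q k p≺q refl refl | just e | just f = p≺q

  Sim-intro : ∀ p q k {e f} → inStep F p (int k) ≡ just e → inStep F q (int k) ≡ just f →
              sameEdge F e f ≡ true → Sim F p q k
  Sim-intro p q k ip iq e~f rewrite ip | iq = e~f

  Prec-irrefl : ∀ p k → ¬ Prec F p p k
  Prec-irrefl p k p≺p with inStep F p (int k)
  ... | just _  = <-irrefl refl (proj₂ p≺p)
  ... | nothing = p≺p

  entering-order : ∀ {v w p q} k {e f} → ValidFrom F v p → ValidFrom F w q →
                   inStep F p (int k) ≡ just e → inStep F q (int k) ≡ just f →
                   Prec F p q k ⊎ (PrecEq F q p k × ¬ Prec F p q k)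
  entering-order {p = p} {q} k {e} {f} vp vq ip iq
    with sameEdge F e f in e~f | toℕ (line F e) <ᵇ toℕ (line F f) in e<f
  ... | false | true  = inj₁ (Prec-intro p q k ip iq e~f (<ᵇ≡true⇒< e<f))
  ... | true  | _     = inj₂ (inj₂ (Sim-intro q p k iq ip (sameEdge-sym e f e~f)) ,
                              λ p≺q → true≢false (trans (sym e~f) (proj₁ (Prec-elim p q k p≺q ip iq))))
  ... | false | false = inj₂ (inj₁ (Prec-intro q p k iq ip (sameEdge-sym-false e f e~f) f<e) ,
                              λ p≺q → <ᵇ≡false⇒≮ e<f (proj₂ (Prec-elim p q k p≺q ip iq)))
    where
    f<e : toℕ (line F f) < toℕ (line F e)
    f<e = ≤∧≢⇒< (≮⇒≥ (<ᵇ≡false⇒≮ e<f)) (≢-sym (entering-lines-differ vp vq ip iq e~f))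

  module Surjection {π π̂ : Family F} (Vπ : Valid π) (Vπ̂ : Valid π̂) (k : Fin m) {s t : Fin n} {es et : LE F}
                    (st-defect : Defect F π s t k)
                    (is : inStep F (π s) (int k) ≡ just es) (it : inStep F (π t) (int k) ≡ just et)
                    (îs : inStep F (π̂ s) (int k) ≡ just et) (ît : inStep F (π̂ t) (int k) ≡ just es)
                    (unchanged : ∀ x → ¬ InST F s t x → π̂ x ≡ π x) where

    Preimage : Fin n → Fin n → Set
    Preimage i′ j′ = ∃₂ λ i j → DSet F π s t k i j × PsiGraph F π s t k i j i′ j′

    s<t : toℕ s < toℕ t
    s<t = proj₁ st-defect

    es≁et : sameEdge F es et ≡ false
    es≁et = proj₁ (defect⇒ Vπ k st-defect is it)

    et<es : toℕ (line F et) < toℕ (line F es)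
    et<es = proj₂ (defect⇒ Vπ k st-defect is it)

    entering-unchanged : ∀ x {e} → ¬ InST F s t x →
                         inStep F (π̂ x) (int k) ≡ just e → inStep F (π x) (int k) ≡ just e
    entering-unchanged x x∉ îx = trans (cong (λ p → inStep F p (int k)) (sym (unchanged x x∉))) îx

    -- were ex and ez merged, so would be ey, whose line lies between theirs
    apart-outer : ∀ {x y z ex ey ez} → inStep F (π x) (int k) ≡ just ex → inStep F (π y) (int k) ≡ just ey →
      inStep F (π z) (int k) ≡ just ez →
      toℕ (line F ex) < toℕ (line F ey) → toℕ (line F ey) < toℕ (line F ez) →
      sameEdge F ey ez ≡ false → sameEdge F ex ez ≡ false
    apart-outer {x} {y} {z} {ex} {ey} {ez} ix iy iz ex<ey ey<ez ey≁ez =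
      ¬-not (λ ex~ez → true≢false (trans (sym (sameEdge-between k ex ey ez (valid-proper (Vπ y) (proj₁ y∈))
        (proj₂ (inStep-just (π x) (int k) ix)) (proj₂ y∈) ex<ey ey<ez ex~ez)) ey≁ez))
      where y∈ = inStep-just (π y) (int k) iy

    preimage-s : ∀ x → ¬ InST F s t x → Defect F π̂ s x k → Preimage s x
    preimage-s x x∉ D̂ with meet⇒entering (π̂ s) (π̂ x) k (proj₁ (proj₂ D̂))
    ... | _ , ex , _ , îx , _ with entering-unchanged x x∉ îx | defect⇒ Vπ̂ k D̂ îs îx
    ...   | ix | et≁ex , ex<et =
      s , x , D , inj₁ (inj₁ (D , x≺t) , refl , refl)
      where
      x≺t = Prec-intro (π x) (π t) k ix it (sameEdge-sym-false et ex et≁ex) ex<et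
      es≁ex = sameEdge-sym-false ex es (apart-outer ix it is ex<et et<es (sameEdge-sym-false es et es≁et))
      D = defect⇐ Vπ k (proj₁ D̂) is ix es≁ex (<-trans ex<et et<es) , inj₁ (inj₁ refl , x∉)

    preimage-t : ∀ x → ¬ InST F s t x → Defect F π̂ t x k → Preimage t x
    preimage-t x x∉ D̂ with meet⇒entering (π̂ t) (π̂ x) k (proj₁ (proj₂ D̂))
    ... | _ , ex , _ , îx , _ with entering-unchanged x x∉ îx | defect⇒ Vπ̂ k D̂ ît îx
    ...   | ix | es≁ex , ex<es with entering-order k (Vπ x) (Vπ t) ix it
    ...     | inj₁ x≺t = t , x , D , inj₁ (inj₁ (D , x≺t) , refl , refl)
      where
      x≺t′ = Prec-elim (π x) (π t) k x≺t ix it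
      D = defect⇐ Vπ k (proj₁ D̂) it ix (sameEdge-sym-false ex et (proj₁ x≺t′)) (proj₂ x≺t′) ,
          inj₁ (inj₂ refl , x∉)
    ...     | inj₂ (t≾x , x⊀t) =
      s , x , D , inj₂ (inj₁ (not-A∪B , (D , t≾x , x≺s , refl , x∉ ∘ inj₂) , refl , refl))
      where
      D = defect⇐ Vπ k (<-trans s<t (proj₁ D̂)) is ix es≁ex ex<es , inj₁ (inj₁ refl , x∉)
      x≺s = Prec-intro (π x) (π s) k ix is (sameEdge-sym-false es ex es≁ex) ex<es
      not-A∪B : ¬ (ASet F π s t k s x ⊎ BSet F π s t k s x)
      not-A∪B (inj₁ (_ , x≺t)) = x⊀t x≺t
      not-A∪B (inj₂ (_ , s≺s)) = Prec-irrefl (π s) k s≺s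

    preimage-to-s : ∀ x → ¬ InST F s t x → Defect F π̂ x s k → Preimage x s
    preimage-to-s x x∉ D̂ with meet⇒entering (π̂ x) (π̂ s) k (proj₁ (proj₂ D̂))
    ... | ex , _ , îx , _ , _ with entering-unchanged x x∉ îx | defect⇒ Vπ̂ k D̂ îx îs
    ...   | ix | ex≁et , et<ex with entering-order k (Vπ s) (Vπ x) is ix
    ...     | inj₁ s≺x = x , s , D , inj₁ (inj₂ (D , s≺x) , refl , refl)
      where
      s≺x′ = Prec-elim (π s) (π x) k s≺x is ix
      D = defect⇐ Vπ k (proj₁ D̂) ix is (sameEdge-sym-false es ex (proj₁ s≺x′)) (proj₂ s≺x′) ,
          inj₂ (x∉ , inj₁ refl)
    ...     | inj₂ (x≾s , s⊀x) =
      x , t , D , inj₂ (inj₂ (not-A∪B , not-C₁ , (D , refl , t≺x , x≾s , x∉ ∘ inj₁) , refl , refl))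
      where
      D = defect⇐ Vπ k (<-trans (proj₁ D̂) s<t) ix it ex≁et et<ex , inj₂ (x∉ , inj₂ refl)
      t≺x = Prec-intro (π t) (π x) k it ix (sameEdge-sym-false ex et ex≁et) et<ex
      not-A∪B : ¬ (ASet F π s t k x t ⊎ BSet F π s t k x t)
      not-A∪B (inj₁ (_ , t≺t)) = Prec-irrefl (π t) k t≺t
      not-A∪B (inj₂ (_ , s≺x)) = s⊀x s≺x
      not-C₁ : ¬ C₁Set F π s t k x t
      not-C₁ (_ , _ , _ , x≡s , _) = x∉ (inj₁ x≡s)

    preimage-to-t : ∀ x → ¬ InST F s t x → Defect F π̂ x t k → Preimage x t
    preimage-to-t x x∉ D̂ with meet⇒entering (π̂ x) (π̂ t) k (proj₁ (proj₂ D̂))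
    ... | ex , _ , îx , _ , _ with entering-unchanged x x∉ îx | defect⇒ Vπ̂ k D̂ îx ît
    ...   | ix | ex≁es , es<ex =
      x , t , D , inj₁ (inj₂ (D , s≺x) , refl , refl)
      where
      s≺x = Prec-intro (π s) (π x) k is ix (sameEdge-sym-false ex es ex≁es) es<ex
      ex≁et = sameEdge-sym-false et ex (apart-outer it is ix et<es es<ex (sameEdge-sym-false ex es ex≁es))
      D = defect⇐ Vπ k (proj₁ D̂) ix it ex≁et (<-trans et<es es<ex) , inj₂ (x∉ , inj₂ refl)

    ψ-surjective : ∀ i′ j′ → DSet F π̂ s t k i′ j′ → Preimage i′ j′
    ψ-surjective .s x (D̂ , inj₁ (inj₁ refl , x∉)) = preimage-s x x∉ D̂
    ψ-surjective .t x (D̂ , inj₁ (inj₂ refl , x∉)) = preimage-t x x∉ D̂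
    ψ-surjective x .s (D̂ , inj₂ (x∉ , inj₁ refl)) = preimage-to-s x x∉ D̂
    ψ-surjective x .t (D̂ , inj₂ (x∉ , inj₂ refl)) = preimage-to-t x x∉ D̂

  swapFam-s : ∀ (π : Family F) s t ℓ k → swapFam F π s t ℓ k s ≡ splice F (int ℓ) (int k) (π s) (π t)
  swapFam-s π s t ℓ k with s ≟ s
  ... | yes _   = refl
  ... | no s≢s = ⊥-elim (s≢s refl)

  swapFam-t : ∀ (π : Family F) s t ℓ k → s ≢ t →
              swapFam F π s t ℓ k t ≡ splice F (int ℓ) (int k) (π t) (π s)
  swapFam-t π s t ℓ k s≢t with t ≟ s | t ≟ t
  ... | yes t≡s | _       = ⊥-elim (s≢t (sym t≡s))
  ... | no _    | yes _   = refl
  ... | no _    | no t≢t = ⊥-elim (t≢t refl)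

  swapFam-other : ∀ (π : Family F) s t ℓ k x → ¬ InST F s t x → swapFam F π s t ℓ k x ≡ π x
  swapFam-other π s t ℓ k x x∉ with x ≟ s | x ≟ t
  ... | yes x≡s | _       = ⊥-elim (x∉ (inj₁ x≡s))
  ... | no _    | yes x≡t = ⊥-elim (x∉ (inj₂ x≡t))
  ... | no _    | no _    = refl

  module Swap {π : Family F} (Vπ : Valid π) {k : Fin m} {s t : Fin n} {es et : LE F}
              (st-defect : Defect F π s t k)
              (is : inStep F (π s) (int k) ≡ just es) (it : inStep F (π t) (int k) ≡ just et)
              {j ℓ : Fin m} (j<k : toℕ j < toℕ k) (crosses : crossᵇ F (π s) (π t) j ≡ true)
              (ends : compEnd F (π s) (π t) (int j) ≡ int ℓ) where

    π̂ : Family F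
    π̂ = swapFam F π s t ℓ k

    s≢t : s ≢ t
    s≢t s≡t = <-irrefl (cong toℕ s≡t) (proj₁ st-defect)

    -- the component of π_s ∩ π_t starting at x_j would otherwise contain the edge into x_k
    ℓ<k : toℕ ℓ < toℕ k
    ℓ<k = ≰⇒> k≰ℓ
      where
      k≰ℓ : ¬ (toℕ k ≤ toℕ ℓ)
      k≰ℓ k≤ℓ with Component.Walk.shared (Component.walk (Vπ s) (Vπ t) (suc m) (int j)) (toℕ k) j<k
                     (subst (λ c → toℕ k < rank c) (sym ends) (s≤s k≤ℓ))
      ... | _ , _ , pe , qf , e~f
        with trans (sym (entering-edgeAt (Vπ s) is)) pe | trans (sym (entering-edgeAt (Vπ t) it)) qf
      ...   | refl | refl = true≢false (trans (sym e~f) (meet-apart (π s) (π t) k (proj₁ (proj₂ st-defect)) is it))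

    entered-ℓ : Entering (π s) (int ℓ) × Entering (π t) (int ℓ)
    entered-ℓ = cross-end-entered (Vπ s) (Vπ t) crosses ends

    spliced-s : ValidFrom F (src s) (splice F (int ℓ) (int k) (π s) (π t)) ×
                inStep F (splice F (int ℓ) (int k) (π s) (π t)) (int k) ≡ just et
    spliced-s = splice-valid ℓ k (Vπ s) (Vπ t) ℓ<k (proj₁ entered-ℓ) (proj₂ entered-ℓ)
                  (_ , inStep-just (π s) (int k) is) it

    spliced-t : ValidFrom F (src t) (splice F (int ℓ) (int k) (π t) (π s)) ×
                inStep F (splice F (int ℓ) (int k) (π t) (π s)) (int k) ≡ just es
    spliced-t = splice-valid ℓ k (Vπ t) (Vπ s) ℓ<k (proj₂ entered-ℓ) (proj₁ entered-ℓ)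
                  (_ , inStep-just (π t) (int k) it) is

    swap-valid : Valid π̂
    swap-valid x = valid-at x (x ≟ s) (x ≟ t)
      where
      valid-at : ∀ x → Dec (x ≡ s) → Dec (x ≡ t) → ValidFrom F (src x) (π̂ x)
      valid-at x (yes refl) _ = subst (ValidFrom F (src x)) (sym (swapFam-s π s t ℓ k)) (proj₁ spliced-s)
      valid-at x (no _) (yes refl) = subst (ValidFrom F (src x)) (sym (swapFam-t π s t ℓ k s≢t)) (proj₁ spliced-t)
      valid-at x (no x≢s) (no x≢t) =
        subst (ValidFrom F (src x)) (sym (swapFam-other π s t ℓ k x [ x≢s , x≢t ])) (Vπ x)

    swap-enters-s : inStep F (π̂ s) (int k) ≡ just et
    swap-enters-s = trans (cong (λ p → inStep F p (int k)) (swapFam-s π s t ℓ k)) (proj₂ spliced-s)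

    swap-enters-t : inStep F (π̂ t) (int k) ≡ just es
    swap-enters-t = trans (cong (λ p → inStep F p (int k)) (swapFam-t π s t ℓ k s≢t)) (proj₂ spliced-t)

lemma4p6 : {n m : ℕ} (F : Star n m) (π : Family F) → Covering F π →
    (k : Fin m) → 1 ≤ toℕ k →
    (r t : Fin n) → Defect F π r t k →
    ((r' t' : Fin n) → Defect F π r' t' k →
      (toℕ r < toℕ r') ⊎ ((r ≡ r') × (toℕ t ≤ toℕ t'))) →
    (s : Fin n) → Sim F (π s) (π r) k → Defect F π s t k →
    ((s' : Fin n) → Sim F (π s') (π r) k → Defect F π s' t k → toℕ s' ≤ toℕ s) →
    (j ℓ : Fin m) → toℕ j < toℕ k → crossᵇ F (π s) (π t) j ≡ true →
    compEnd F (π s) (π t) (int j) ≡ int ℓ →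
    ((j' : Fin m) → toℕ j < toℕ j' → toℕ j' < toℕ k → crossᵇ F (π s) (π t) j' ≡ false) →
    (i' j' : Fin n) → DSet F (swapFam F π s t ℓ k) s t k i' j' →
    ∃₂ λ i j → DSet F π s t k i j × PsiGraph F π s t k i j i' j'
lemma4p6 F π cov k _ _ t _ _ s _ st-defect _ j ℓ j<k crosses ends _
  with meet⇒entering F (π s) (π t) k (proj₁ (proj₂ st-defect))
... | _ , _ , is , it , _ = ψ-surjective
  where
  open Swap F (proj₁ cov) st-defect is it j<k crosses ends
  open Surjection F (proj₁ cov) swap-valid k st-defect is it swap-enters-s swap-enters-t (swapFam-other F π s t ℓ k)
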